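{- Let $V$ be a finite set with $v=|V|$ and let $f$ be a positive integer. For every $E\in P_V$, $$\chi_E(f)=\sum_{H\in P_V}(M_{1/f})_{E,H}\,f^{c(H)},$$ i.e. $\chi(f)=M_{f^{ -1}}f^c$ as vectors in $\mathbb{C}^{P_V}$, where $\chi_E(f)$ is the chromatic polynomial of the graph $(V,E)$ evaluated at $f$ and $[f^c]_H=f^{c(H)}$.
   Context: For an edge set $E\subseteq\binom{V}{2}$, $c(E)$ is the number of connected components of $(V,E)$. $P_V=\{E\subseteq\binom{V}{2} : c(E)=c(E\setminus\{t\})\text{ for every }t\in E\}$ (isthmus-free edge sets, including $\emptyset$). The chromatic polynomial value $\chi_E(f)$ is the number of maps $X:V\to\{1,\dots,f\}$ with $X_u\neq X_w$ for every $\{u,w\}\in E$ (equivalently $f^v[\Gamma^{F\setminus\{0\}}]_E$ for any Abelian group $F$ of order $f$). For $r\in\mathbb{C}$, $J_r$ is the linear operator on $\mathbb{C}^{P_V}$ with $[J_r x]_E=\sum_{H\in P_V,\ H\subseteq E} r^{|E|-|H|}[x]_H$, $(-1)^e$ is the diagonal operator $[(-1)^e x]_E=(-1)^{|E|}[x]_E$, $M_r=J_{1-r}(-1)^eJ_r^{ -1}$, and $(M_r)_{E,H}$ denotes its entry with $[M_r x]_E=\sum_H (M_r)_{E,H}[x]_H$. -}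

module Defs where

open import Data.Nat as ℕ using (ℕ; zero; suc; _∸_)
open import Data.Fin as Fin using (Fin; toℕ)
open import Data.Bool using (Bool; true; false; _∧_; _∨_; not; if_then_else_)
open import Data.List as List using (List; []; _∷_; [_]; _++_; map; concatMap; allFin; length; filterᵇ; foldr)
open import Data.Bool.ListAction using (any; all)
open import Data.Vec as Vec using (Vec)
open import Data.Product using (_×_; _,_; proj₁; proj₂)
open import Data.Integer using (+_)
open import Data.Rational as ℚ using (ℚ; 0ℚ; 1ℚ; _+_; _*_; -_)
open import Relation.Nullary.Decidable using (⌊_⌋)
open import Relation.Binary.PropositionalEquality using (_≡_)
open import Data.List.Membership.Propositional using (_∈_)

-- Vertex set V = Fin v.  Potential edges: pairs (i , j) with i < j.
pairs : (v : ℕ) → List (Fin v × Fin v)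
pairs v = concatMap (λ i → concatMap (λ j → if toℕ i ℕ.<ᵇ toℕ j then [ (i , j) ] else []) (allFin v)) (allFin v)

NE : ℕ → ℕ
NE v = length (pairs v)

-- An edge set E ⊆ binom(V,2), as a characteristic vector over all potential edges.
record EdgeSet (v : ℕ) : Set where
  constructor mkE
  field bits : Vec Bool (NE v)
open EdgeSet public

_∋_ : {v : ℕ} → EdgeSet v → Fin (NE v) → Bool
E ∋ t = Vec.lookup (bits E) t

endpoints : {v : ℕ} → Fin (NE v) → Fin v × Fin v
endpoints {v} t = List.lookup (pairs v) t

allSubsets : (n : ℕ) → List (Vec Bool n)
allSubsets zero = Vec.[] ∷ []
allSubsets (suc n) = map (true Vec.∷_) (allSubsets n) ++ map (false Vec.∷_) (allSubsets n)

_==_ : {v : ℕ} → Fin v → Fin v → Bool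
a == b = ⌊ a Fin.≟ b ⌋

adj : {v : ℕ} → EdgeSet v → Fin v → Fin v → Bool
adj {v} E u w = any (λ t → (E ∋ t) ∧
  (((proj₁ (endpoints t) == u) ∧ (proj₂ (endpoints t) == w)) ∨
   ((proj₁ (endpoints t) == w) ∧ (proj₂ (endpoints t) == u)))) (allFin (NE v))

reachN : {v : ℕ} → ℕ → EdgeSet v → Fin v → Fin v → Bool
reachN zero E u w = u == w
reachN {v} (suc k) E u w = reachN k E u w ∨ any (λ x → reachN k E u x ∧ adj E x w) (allFin v)

-- connectivity in (V,E): walks of length ≤ v suffice
connected : {v : ℕ} → EdgeSet v → Fin v → Fin v → Bool
connected {v} E = reachN v E

countᵇ : {A : Set} → (A → Bool) → List A → ℕ
countᵇ p xs = length (filterᵇ p xs)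

-- c(E): number of connected components = number of vertices that are the
-- least vertex of their component
c : {v : ℕ} → EdgeSet v → ℕ
c {v} E = countᵇ (λ u → not (any (λ w → (toℕ w ℕ.<ᵇ toℕ u) ∧ connected E w u) (allFin v))) (allFin v)

removeEdge : {v : ℕ} → EdgeSet v → Fin (NE v) → EdgeSet v
removeEdge E t = mkE (Vec.updateAt (bits E) t (λ _ → false))

isthmusFree : {v : ℕ} → EdgeSet v → Bool
isthmusFree {v} E = all (λ t → not ((E ∋ t)) ∨ (c E ℕ.≡ᵇ c (removeEdge E t))) (allFin (NE v))

-- P_V as a list (each isthmus-free edge set exactly once)
P : (v : ℕ) → List (EdgeSet v)
P v = filterᵇ isthmusFree (map mkE (allSubsets (NE v)))

size : {v : ℕ} → EdgeSet v → ℕ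
size E = Vec.count (λ b → b Data.Bool.≟ true) (bits E)
  where import Data.Bool

_⊆ᵇ_ : {v : ℕ} → EdgeSet v → EdgeSet v → Bool
mkE H ⊆ᵇ mkE E = Vec.foldr _ _∧_ true (Vec.zipWith (λ h e → not h ∨ e) H E)

eqᵇ : {v : ℕ} → EdgeSet v → EdgeSet v → Bool
eqᵇ H E = (H ⊆ᵇ E) ∧ (E ⊆ᵇ H)

_^ℚ_ : ℚ → ℕ → ℚ
r ^ℚ zero = 1ℚ
r ^ℚ suc n = r * (r ^ℚ n)

fromℕ : ℕ → ℚ
fromℕ n = (+ n) ℚ./ 1

-- matrices indexed by edge sets (only entries indexed by P_V matter)
Mat : ℕ → Set
Mat v = EdgeSet v → EdgeSet v → ℚ

sumP : (v : ℕ) → (EdgeSet v → ℚ) → ℚ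
sumP v g = foldr (λ H acc → g H + acc) 0ℚ (P v)

_·_ : {v : ℕ} → Mat v → Mat v → Mat v
_·_ {v} A B E H = sumP v (λ G → A E G * B G H)

δ : {v : ℕ} → Mat v
δ E H = if eqᵇ E H then 1ℚ else 0ℚ

J : (v : ℕ) → ℚ → Mat v
J v r E H = if H ⊆ᵇ E then r ^ℚ (size E ∸ size H) else 0ℚ

signMat : (v : ℕ) → Mat v
signMat v E H = if eqᵇ E H then (- 1ℚ) ^ℚ size E else 0ℚ

IsInverse : (v : ℕ) → Mat v → Mat v → Set
IsInverse v A K = (E H : EdgeSet v) → E ∈ P v → H ∈ P v →
  ((A · K) E H ≡ δ E H) × ((K · A) E H ≡ δ E H)

M : (v : ℕ) → ℚ → (Jinv : Mat v) → Mat v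
M v r Jinv = (J v (1ℚ ℚ.- r) · signMat v) · Jinv

allMaps : (v f : ℕ) → List (Vec (Fin f) v)
allMaps zero f = Vec.[] ∷ []
allMaps (suc v) f = concatMap (λ x → map (x Vec.∷_) (allMaps v f)) (allFin f)

proper : {v f : ℕ} → EdgeSet v → Vec (Fin f) v → Bool
proper {v} E X = all (λ t → not ((E ∋ t)) ∨
  not (Vec.lookup X (proj₁ (endpoints t)) == Vec.lookup X (proj₂ (endpoints t)))) (allFin (NE v))

chromatic : (v f : ℕ) → EdgeSet v → ℕ
chromatic v f E = countᵇ (proper E) (allMaps v f)

-- Put r = 1/f and y = J_{-r} f^c, computed on the Boolean lattice of all edge sets, so that
-- f^c = J_r y. If t is an isthmus of H then, for K ⊆ H ∖ t, adding t to K merges two components,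
-- so f^{c(K)} = f · f^{c(K+t)} and the terms of y_H at K and K + t cancel: y vanishes off P_V,
-- and therefore J_r⁻¹ f^c = y on P_V. Since (-1)^e J_{-r} = J_r (-1)^e and J_a J_b = J_{a+b},
-- M_r f^c = J_{1-r} (-1)^e y = J_1 (-1)^e f^c, whose E-entry Σ_{K ⊆ E} (-1)^{|K|} f^{c(K)} is
-- Whitney's expansion of χ_E(f): f^{c(K)} counts the colourings constant on the components of K,
-- and inclusion–exclusion over K ⊆ E leaves the proper colourings.

module Submission where

open import Defs
open import Data.Bool using (Bool; true; false; if_then_else_; _∧_; _∨_; not)
import Data.Bool.Properties as 𝔹
open import Data.Bool.ListAction using (any; all)
open import Data.Empty using (⊥-elim)
open import Data.Fin as Fin using (Fin; toℕ)
import Data.Fin.Properties as FinP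
import Data.Integer as ℤ
import Data.Integer.Properties as ℤP
open import Data.List as List using (List; []; _∷_; _++_; map; foldr; filterᵇ; allFin; length; concatMap)
open import Data.List.Membership.Propositional using (_∈_)
open import Data.List.Membership.Propositional.Properties using (∈-allFin; ∈-filter⁻)
import Data.List.Properties as ListP
open import Data.List.Relation.Unary.Any using (here; there)
open import Data.Nat as ℕ using (ℕ; zero; suc; NonZero; _≤_; _<_; z≤n; s≤s; _^_; _∸_)
import Data.Nat.Coprimality as ℕC
import Data.Nat.Properties as ℕP
open import Data.Product using (Σ; _×_; _,_; proj₁; proj₂)
open import Data.Rational as ℚ using (ℚ; 0ℚ; 1ℚ; _+_; _*_; -_; _/_; _-_)
import Data.Rational.Properties as ℚP
open import Data.Rational.Solver using (module +-*-Solver)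
import Data.Rational.Unnormalised as ℚᵘ
import Data.Rational.Unnormalised.Properties as ℚᵘP
open import Data.Sum using (_⊎_; inj₁; inj₂; [_,_]′; map₂)
open import Data.Vec as Vec using (Vec; []; _∷_)
import Data.Vec.Properties as VecP
open import Function using (_∘_; mk⇔)
open import Function.Bundles using (Equivalence)
open import Relation.Binary.Definitions using (tri<; tri≈; tri>)
open import Relation.Binary.PropositionalEquality hiding (J)
open import Relation.Nullary using (¬_; yes; no)
open import Relation.Nullary.Decidable using (isYes≗does; does-⇔; T?)

open +-*-Solver

private
  variable
    A B : Set

true≢false : true ≢ false
true≢false ()

∨-true : ∀ {a b} → a ∨ b ≡ true → a ≡ true ⊎ b ≡ true
∨-true {true}  _ = inj₁ refl
∨-true {false} e = inj₂ e

∧-true : ∀ {a b} → a ∧ b ≡ true → a ≡ true × b ≡ true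
∧-true {a} {b} e = 𝔹.∧-conicalˡ a b e , 𝔹.∧-conicalʳ a b e

≡true-ext : ∀ {a b} → (a ≡ true → b ≡ true) → (b ≡ true → a ≡ true) → a ≡ b
≡true-ext {true}  {true}  _ _ = refl
≡true-ext {true}  {false} f _ = sym (f refl)
≡true-ext {false} {true}  _ g = g refl
≡true-ext {false} {false} _ _ = refl

any-elim : ∀ (p : A → Bool) xs → any p xs ≡ true → Σ A λ x → x ∈ xs × p x ≡ true
any-elim p (x ∷ xs) e with p x in px
... | true  = x , here refl , px
... | false = let y , y∈ , py = any-elim p xs e in y , there y∈ , py

any-intro : ∀ (p : A → Bool) xs {x} → x ∈ xs → p x ≡ true → any p xs ≡ true
any-intro p (y ∷ xs) (here refl) px rewrite px = refl
any-intro p (y ∷ xs) (there x∈) px = trans (cong (p y ∨_) (any-intro p xs x∈ px)) (𝔹.∨-zeroʳ (p y))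

all-elim : ∀ (p : A → Bool) xs → all p xs ≡ true → ∀ {x} → x ∈ xs → p x ≡ true
all-elim p (y ∷ xs) e (here refl) = 𝔹.∧-conicalˡ _ _ e
all-elim p (y ∷ xs) e (there x∈) = all-elim p xs (𝔹.∧-conicalʳ _ _ e) x∈

all-intro : ∀ (p : A → Bool) xs → (∀ x → x ∈ xs → p x ≡ true) → all p xs ≡ true
all-intro p []       _ = refl
all-intro p (y ∷ xs) h rewrite h y (here refl) = all-intro p xs (λ x x∈ → h x (there x∈))

all≡false⇒∃ : ∀ (p : A → Bool) xs → all p xs ≡ false → Σ A λ x → x ∈ xs × p x ≡ false
all≡false⇒∃ p (x ∷ xs) e with p x in px
... | false = x , here refl , px
... | true  = let y , y∈ , py = all≡false⇒∃ p xs e in y , there y∈ , py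

any-cong : ∀ {p q : A → Bool} xs → (∀ x → p x ≡ q x) → any p xs ≡ any q xs
any-cong []       _ = refl
any-cong (x ∷ xs) h = cong₂ _∨_ (h x) (any-cong xs h)

all-cong : ∀ {p q : A → Bool} xs → (∀ x → p x ≡ q x) → all p xs ≡ all q xs
all-cong []       _ = refl
all-cong (x ∷ xs) h = cong₂ _∧_ (h x) (all-cong xs h)

all-map : ∀ (p : B → Bool) (g : A → B) xs → all p (map g xs) ≡ all (p ∘ g) xs
all-map p g []       = refl
all-map p g (x ∷ xs) = cong (p (g x) ∧_) (all-map p g xs)

countᵇ-cong : ∀ {p q : A → Bool} xs → (∀ x → p x ≡ q x) → countᵇ p xs ≡ countᵇ q xs
countᵇ-cong []       _ = refl
countᵇ-cong {p = p} {q} (x ∷ xs) h with p x | q x | h x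
... | true  | .true  | refl = cong suc (countᵇ-cong xs h)
... | false | .false | refl = countᵇ-cong xs h

countᵇ-map : ∀ (p : B → Bool) (g : A → B) xs → countᵇ p (map g xs) ≡ countᵇ (p ∘ g) xs
countᵇ-map p g []       = refl
countᵇ-map p g (x ∷ xs) with p (g x)
... | true  = cong suc (countᵇ-map p g xs)
... | false = countᵇ-map p g xs

countᵇ-++ : ∀ (p : A → Bool) xs ys → countᵇ p (xs ++ ys) ≡ countᵇ p xs ℕ.+ countᵇ p ys
countᵇ-++ p xs ys = trans (cong length (ListP.filter-++ (T? ∘ p) xs ys)) (ListP.length-++ (filterᵇ p xs))

countᵇ-false : ∀ (xs : List A) → countᵇ (λ _ → false) xs ≡ 0
countᵇ-false []       = refl
countᵇ-false (_ ∷ xs) = countᵇ-false xs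

countᵇ-≤-length : ∀ (p : A → Bool) xs → countᵇ p xs ≤ length xs
countᵇ-≤-length p = ListP.length-filter (T? ∘ p)

countᵇ-mono : ∀ (p q : A → Bool) xs → (∀ x → p x ≡ true → q x ≡ true) → countᵇ p xs ≤ countᵇ q xs
countᵇ-mono p q []       h = z≤n
countᵇ-mono p q (x ∷ xs) h with p x in px | q x in qx
... | true  | true  = s≤s (countᵇ-mono p q xs h)
... | true  | false = ⊥-elim (true≢false (trans (sym (h x px)) qx))
... | false | true  = ℕP.m≤n⇒m≤1+n (countᵇ-mono p q xs h)
... | false | false = countᵇ-mono p q xs h

countᵇ-< : ∀ (p q : A → Bool) xs → (∀ x → p x ≡ true → q x ≡ true) →
  ∀ {x} → x ∈ xs → q x ≡ true → p x ≡ false → countᵇ p xs < countᵇ q xs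
countᵇ-< p q (y ∷ xs) h (here refl) qx px rewrite qx | px = s≤s (countᵇ-mono p q xs h)
countᵇ-< p q (y ∷ xs) h (there x∈) qx px with p y in py | q y in qy
... | true  | true  = s≤s (countᵇ-< p q xs h x∈ qx px)
... | true  | false = ⊥-elim (true≢false (trans (sym (h y py)) qy))
... | false | true  = ℕP.m≤n⇒m≤1+n (countᵇ-< p q xs h x∈ qx px)
... | false | false = countᵇ-< p q xs h x∈ qx px

countᵇ-pos : ∀ (p : A → Bool) xs {x} → x ∈ xs → p x ≡ true → 1 ≤ countᵇ p xs
countᵇ-pos p xs x∈ px = ℕP.≤-trans (s≤s z≤n) (countᵇ-< (λ _ → false) p xs (λ _ ()) x∈ px refl)

countᵇ-split : ∀ (p q : A → Bool) xs →
  countᵇ p xs ≡ countᵇ (λ x → p x ∧ q x) xs ℕ.+ countᵇ (λ x → p x ∧ not (q x)) xs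
countᵇ-split p q []       = refl
countᵇ-split p q (x ∷ xs) with p x | q x
... | true  | true  = cong suc (countᵇ-split p q xs)
... | true  | false = trans (cong suc (countᵇ-split p q xs)) (sym (ℕP.+-suc _ _))
... | false | _     = countᵇ-split p q xs

sumℕ : List A → (A → ℕ) → ℕ
sumℕ xs g = foldr (λ x acc → g x ℕ.+ acc) 0 xs

sumℕ-cong : ∀ (xs : List A) {g h : A → ℕ} → (∀ x → g x ≡ h x) → sumℕ xs g ≡ sumℕ xs h
sumℕ-cong []       _ = refl
sumℕ-cong (x ∷ xs) e = cong₂ ℕ._+_ (e x) (sumℕ-cong xs e)

sumℕ-const : ∀ (xs : List A) k → sumℕ xs (λ _ → k) ≡ length xs ℕ.* k
sumℕ-const []       k = refl
sumℕ-const (x ∷ xs) k = cong (k ℕ.+_) (sumℕ-const xs k)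

sumℕ-map : ∀ (g : A → B) xs (h : B → ℕ) → sumℕ (map g xs) h ≡ sumℕ xs (h ∘ g)
sumℕ-map g []       h = refl
sumℕ-map g (x ∷ xs) h = cong (h (g x) ℕ.+_) (sumℕ-map g xs h)

countᵇ-concatMap : ∀ (p : B → Bool) (g : A → List B) xs →
  countᵇ p (concatMap g xs) ≡ sumℕ xs (countᵇ p ∘ g)
countᵇ-concatMap p g []       = refl
countᵇ-concatMap p g (x ∷ xs) =
  trans (countᵇ-++ p (g x) (concatMap g xs)) (cong (countᵇ p (g x) ℕ.+_) (countᵇ-concatMap p g xs))

==-refl : ∀ {n} (a : Fin n) → (a == a) ≡ true
==-refl a with a Fin.≟ a
... | yes _   = refl
... | no a≢a = ⊥-elim (a≢a refl)

==⇒≡ : ∀ {n} {a b : Fin n} → (a == b) ≡ true → a ≡ b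
==⇒≡ {a = a} {b} e with a Fin.≟ b
... | yes a≡b = a≡b

==-suc : ∀ {n} (a b : Fin n) → (Fin.suc a == Fin.suc b) ≡ (a == b)
==-suc a b = trans (isYes≗does (Fin.suc a Fin.≟ Fin.suc b))
  (trans (does-⇔ (mk⇔ FinP.suc-injective (cong Fin.suc)) (Fin.suc a Fin.≟ Fin.suc b) (a Fin.≟ b)) (sym (isYes≗does (a Fin.≟ b))))

allFin-suc : ∀ n → allFin (suc n) ≡ Fin.zero ∷ map Fin.suc (allFin n)
allFin-suc n = cong (Fin.zero ∷_) (sym (ListP.map-tabulate (λ x → x) Fin.suc))

length-allFin : ∀ n → length (allFin n) ≡ n
length-allFin n = ListP.length-tabulate (λ x → x)

countᵇ-== : ∀ {n} (m : Fin n) → countᵇ (_== m) (allFin n) ≡ 1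
countᵇ-== {suc n} Fin.zero = begin
  countᵇ (_== Fin.zero) (allFin (suc n))                         ≡⟨ cong (countᵇ (_== Fin.zero)) (allFin-suc n) ⟩
  suc (countᵇ (_== Fin.zero) (map Fin.suc (allFin n)))           ≡⟨ cong suc (countᵇ-map _ Fin.suc (allFin n)) ⟩
  suc (countᵇ (λ _ → false) (allFin n))                           ≡⟨ cong suc (countᵇ-false (allFin n)) ⟩
  1 ∎
  where open ≡-Reasoning
countᵇ-== {suc n} (Fin.suc m) = begin
  countᵇ (_== Fin.suc m) (allFin (suc n))               ≡⟨ cong (countᵇ (_== Fin.suc m)) (allFin-suc n) ⟩
  countᵇ (_== Fin.suc m) (map Fin.suc (allFin n))       ≡⟨ countᵇ-map _ Fin.suc (allFin n) ⟩
  countᵇ (λ u → Fin.suc u == Fin.suc m) (allFin n)      ≡⟨ countᵇ-cong (allFin n) (λ u → ==-suc u m) ⟩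
  countᵇ (_== m) (allFin n)                             ≡⟨ countᵇ-== m ⟩
  1 ∎
  where open ≡-Reasoning

countᵇ-remove : ∀ {n} (p : Fin n → Bool) (m : Fin n) → p m ≡ true →
  countᵇ p (allFin n) ≡ suc (countᵇ (λ u → p u ∧ not (u == m)) (allFin n))
countᵇ-remove {n} p m pm =
  trans (countᵇ-split p (_== m) (allFin n))
        (cong (ℕ._+ countᵇ (λ u → p u ∧ not (u == m)) (allFin n)) (trans (countᵇ-cong (allFin n) p∧==m) (countᵇ-== m)))
  where
  p∧==m : ∀ u → (p u ∧ (u == m)) ≡ (u == m)
  p∧==m u with u == m in e
  ... | false = 𝔹.∧-zeroʳ (p u)
  ... | true rewrite ==⇒≡ e = trans (𝔹.∧-identityʳ (p m)) pm

sumℚ : List A → (A → ℚ) → ℚ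
sumℚ xs g = foldr (λ x acc → g x + acc) 0ℚ xs

sumℚ-++ : ∀ (xs ys : List A) g → sumℚ (xs ++ ys) g ≡ sumℚ xs g + sumℚ ys g
sumℚ-++ []       ys g = sym (ℚP.+-identityˡ _)
sumℚ-++ (x ∷ xs) ys g = trans (cong (g x +_) (sumℚ-++ xs ys g)) (sym (ℚP.+-assoc (g x) _ _))

sumℚ-map : ∀ (h : A → B) xs g → sumℚ (map h xs) g ≡ sumℚ xs (g ∘ h)
sumℚ-map h []       g = refl
sumℚ-map h (x ∷ xs) g = cong (g (h x) +_) (sumℚ-map h xs g)

sumℚ-cong∈ : ∀ (xs : List A) {g h : A → ℚ} → (∀ x → x ∈ xs → g x ≡ h x) → sumℚ xs g ≡ sumℚ xs h
sumℚ-cong∈ []       _ = refl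
sumℚ-cong∈ (x ∷ xs) e = cong₂ _+_ (e x (here refl)) (sumℚ-cong∈ xs (λ y y∈ → e y (there y∈)))

sumℚ-cong : ∀ (xs : List A) {g h : A → ℚ} → (∀ x → g x ≡ h x) → sumℚ xs g ≡ sumℚ xs h
sumℚ-cong xs e = sumℚ-cong∈ xs (λ x _ → e x)

sumℚ-0 : ∀ (xs : List A) {g : A → ℚ} → (∀ x → g x ≡ 0ℚ) → sumℚ xs g ≡ 0ℚ
sumℚ-0 []       _ = refl
sumℚ-0 (x ∷ xs) e = trans (cong₂ _+_ (e x) (sumℚ-0 xs e)) (ℚP.+-identityˡ 0ℚ)

sumℚ-+ : ∀ (xs : List A) (g h : A → ℚ) → sumℚ xs (λ x → g x + h x) ≡ sumℚ xs g + sumℚ xs h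
sumℚ-+ []       g h = refl
sumℚ-+ (x ∷ xs) g h = trans (cong (g x + h x +_) (sumℚ-+ xs g h))
  (solve 4 (λ a b c d → (a :+ b) :+ (c :+ d) := (a :+ c) :+ (b :+ d)) refl (g x) (h x) (sumℚ xs g) (sumℚ xs h))

sumℚ-*ˡ : ∀ (xs : List A) a (g : A → ℚ) → sumℚ xs (λ x → a * g x) ≡ a * sumℚ xs g
sumℚ-*ˡ []       a g = sym (ℚP.*-zeroʳ a)
sumℚ-*ˡ (x ∷ xs) a g = trans (cong (a * g x +_) (sumℚ-*ˡ xs a g)) (sym (ℚP.*-distribˡ-+ a _ _))

sumℚ-*ʳ : ∀ (xs : List A) a (g : A → ℚ) → sumℚ xs (λ x → g x * a) ≡ sumℚ xs g * a
sumℚ-*ʳ xs a g = trans (sumℚ-cong xs (λ x → ℚP.*-comm (g x) a)) (trans (sumℚ-*ˡ xs a g) (ℚP.*-comm a _))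

sumℚ-comm : ∀ (xs : List A) (ys : List B) (g : A → B → ℚ) →
  sumℚ xs (λ x → sumℚ ys (g x)) ≡ sumℚ ys (λ y → sumℚ xs (λ x → g x y))
sumℚ-comm []       ys g = sym (sumℚ-0 ys (λ _ → refl))
sumℚ-comm (x ∷ xs) ys g = trans (cong (sumℚ ys (g x) +_) (sumℚ-comm xs ys g))
  (sym (sumℚ-+ ys (g x) (λ y → sumℚ xs (λ x' → g x' y))))

sumℚ-filterᵇ : ∀ (p : A → Bool) xs (g : A → ℚ) →
  sumℚ (filterᵇ p xs) g ≡ sumℚ xs (λ x → if p x then g x else 0ℚ)
sumℚ-filterᵇ p []       g = refl
sumℚ-filterᵇ p (x ∷ xs) g with p x
... | true  = cong (g x +_) (sumℚ-filterᵇ p xs g)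
... | false = trans (sumℚ-filterᵇ p xs g) (sym (ℚP.+-identityˡ _))

-- The Boolean lattice of subsets of an n-set

sumSubsets : ∀ n → (Vec Bool n → ℚ) → ℚ
sumSubsets n = sumℚ (allSubsets n)

sumSubsets-suc : ∀ n (g : Vec Bool (suc n) → ℚ) →
  sumSubsets (suc n) g ≡ sumSubsets n (g ∘ (true ∷_)) + sumSubsets n (g ∘ (false ∷_))
sumSubsets-suc n g = trans (sumℚ-++ (map (true ∷_) (allSubsets n)) _ g)
  (cong₂ _+_ (sumℚ-map (true ∷_) (allSubsets n) g) (sumℚ-map (false ∷_) (allSubsets n) g))

-- weight a G H is a ^ |G ∖ H| if H ⊆ G and 0 otherwise: the (G , H) entry of J_a.
weight : ∀ {n} → ℚ → Vec Bool n → Vec Bool n → ℚ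
weight a []         []         = 1ℚ
weight a (true ∷ G)  (true ∷ H)  = weight a G H
weight a (true ∷ G)  (false ∷ H) = a * weight a G H
weight a (false ∷ G) (true ∷ H)  = 0ℚ
weight a (false ∷ G) (false ∷ H) = weight a G H

transform : ∀ n → ℚ → (Vec Bool n → ℚ) → Vec Bool n → ℚ
transform n a g G = sumSubsets n (λ K → weight a G K * g K)

weight-convolution : ∀ n a b (G K : Vec Bool n) →
  sumSubsets n (λ H → weight a G H * weight b H K) ≡ weight (a + b) G K
weight-convolution zero a b [] [] = ℚP.+-identityʳ 1ℚ
weight-convolution (suc n) a b (true ∷ G) (true ∷ K) =
  trans (sumSubsets-suc n (λ H → weight a (true ∷ G) H * weight b H (true ∷ K)))
    (trans (cong₂ _+_ (weight-convolution n a b G K) (sumℚ-0 (allSubsets n) (λ H → ℚP.*-zeroʳ (a * weight a G H))))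
           (ℚP.+-identityʳ _))
weight-convolution (suc n) a b (true ∷ G) (false ∷ K) =
  trans (sumSubsets-suc n (λ H → weight a (true ∷ G) H * weight b H (false ∷ K)))
    (trans (cong₂ _+_
      (trans (sumℚ-cong (allSubsets n) (λ H → solve 3 (λ x y z → x :* (y :* z) := y :* (x :* z)) refl (weight a G H) b (weight b H K)))
             (sumℚ-*ˡ (allSubsets n) b _))
      (trans (sumℚ-cong (allSubsets n) (λ H → ℚP.*-assoc a (weight a G H) (weight b H K))) (sumℚ-*ˡ (allSubsets n) a _)))
    (trans (cong₂ (λ u w → b * u + a * w) (weight-convolution n a b G K) (weight-convolution n a b G K))
      (solve 3 (λ a b p → b :* p :+ a :* p := (a :+ b) :* p) refl a b (weight (a + b) G K))))
weight-convolution (suc n) a b (false ∷ G) (true ∷ K) =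
  trans (sumSubsets-suc n (λ H → weight a (false ∷ G) H * weight b H (true ∷ K)))
    (cong₂ _+_ (sumℚ-0 (allSubsets n) (λ H → ℚP.*-zeroˡ (weight b H K)))
               (sumℚ-0 (allSubsets n) (λ H → ℚP.*-zeroʳ (weight a G H))))
weight-convolution (suc n) a b (false ∷ G) (false ∷ K) =
  trans (sumSubsets-suc n (λ H → weight a (false ∷ G) H * weight b H (false ∷ K)))
    (trans (cong₂ _+_ (sumℚ-0 (allSubsets n) (λ H → ℚP.*-zeroˡ (b * weight b H K))) (weight-convolution n a b G K))
           (ℚP.+-identityˡ _))

transform-0 : ∀ n (g : Vec Bool n → ℚ) G → transform n 0ℚ g G ≡ g G
transform-0 zero g [] = trans (ℚP.+-identityʳ _) (ℚP.*-identityˡ _)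
transform-0 (suc n) g (true ∷ G) =
  trans (sumSubsets-suc n (λ K → weight 0ℚ (true ∷ G) K * g K))
    (trans (cong₂ _+_ (transform-0 n (g ∘ (true ∷_)) G)
                      (sumℚ-0 (allSubsets n) (λ K → trans (cong (_* g (false ∷ K)) (ℚP.*-zeroˡ (weight 0ℚ G K))) (ℚP.*-zeroˡ (g (false ∷ K))))))
           (ℚP.+-identityʳ _))
transform-0 (suc n) g (false ∷ G) =
  trans (sumSubsets-suc n (λ K → weight 0ℚ (false ∷ G) K * g K))
    (trans (cong₂ _+_ (sumℚ-0 (allSubsets n) (λ K → ℚP.*-zeroˡ (g (true ∷ K)))) (transform-0 n (g ∘ (false ∷_)) G))
           (ℚP.+-identityˡ _))

transform-∘ : ∀ n a b (g : Vec Bool n → ℚ) G → transform n a (transform n b g) G ≡ transform n (a + b) g G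
transform-∘ n a b g G = begin
  sumSubsets n (λ H → weight a G H * sumSubsets n (λ K → weight b H K * g K))
    ≡⟨ sumℚ-cong (allSubsets n) (λ H → sym (sumℚ-*ˡ (allSubsets n) (weight a G H) _)) ⟩
  sumSubsets n (λ H → sumSubsets n (λ K → weight a G H * (weight b H K * g K)))
    ≡⟨ sumℚ-comm (allSubsets n) (allSubsets n) (λ H K → weight a G H * (weight b H K * g K)) ⟩
  sumSubsets n (λ K → sumSubsets n (λ H → weight a G H * (weight b H K * g K)))
    ≡⟨ sumℚ-cong (allSubsets n) (λ K → trans (sumℚ-cong (allSubsets n) (λ H → sym (ℚP.*-assoc (weight a G H) (weight b H K) (g K))))
                                              (sumℚ-*ʳ (allSubsets n) (g K) (λ H → weight a G H * weight b H K))) ⟩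
  sumSubsets n (λ K → sumSubsets n (λ H → weight a G H * weight b H K) * g K)
    ≡⟨ sumℚ-cong (allSubsets n) (λ K → cong (_* g K) (weight-convolution n a b G K)) ⟩
  transform n (a + b) g G ∎
  where open ≡-Reasoning

transform-inverse : ∀ n r (g : Vec Bool n → ℚ) G → transform n r (transform n (- r) g) G ≡ g G
transform-inverse n r g G =
  trans (transform-∘ n r (- r) g G)
        (trans (cong (λ a → transform n a g G) (ℚP.+-inverseʳ r)) (transform-0 n g G))

sign : ∀ {n} → Vec Bool n → ℚ
sign []         = 1ℚ
sign (true ∷ G)  = - sign G
sign (false ∷ G) = sign G

sign-weight : ∀ {n} a (G K : Vec Bool n) → sign G * weight (- a) G K ≡ weight a G K * sign K
sign-weight a [] [] = refl
sign-weight a (true ∷ G) (true ∷ K) =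
  trans (sym (ℚP.neg-distribˡ-* (sign G) (weight (- a) G K)))
        (trans (cong -_ (sign-weight a G K)) (ℚP.neg-distribʳ-* (weight a G K) (sign K)))
sign-weight a (true ∷ G) (false ∷ K) =
  trans (solve 3 (λ s a p → (:- s) :* ((:- a) :* p) := a :* (s :* p)) refl (sign G) a (weight (- a) G K))
        (trans (cong (a *_) (sign-weight a G K)) (sym (ℚP.*-assoc a _ _)))
sign-weight a (false ∷ G) (true ∷ K) = trans (ℚP.*-zeroʳ (sign G)) (sym (ℚP.*-zeroˡ (- sign K)))
sign-weight a (false ∷ G) (false ∷ K) = sign-weight a G K

sign-transform : ∀ n a (g : Vec Bool n → ℚ) G →
  sign G * transform n (- a) g G ≡ transform n a (λ K → sign K * g K) G
sign-transform n a g G =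
  trans (sym (sumℚ-*ˡ (allSubsets n) (sign G) (λ K → weight (- a) G K * g K)))
        (sumℚ-cong (allSubsets n) (λ K →
          trans (sym (ℚP.*-assoc (sign G) _ (g K)))
                (trans (cong (_* g K) (sign-weight a G K)) (ℚP.*-assoc (weight a G K) (sign K) (g K)))))

-- J_{1-r} (-1)^e J_r⁻¹ = J_1 (-1)^e on the whole Boolean lattice.
transform-sign-conjugate : ∀ n r (g : Vec Bool n → ℚ) E →
  transform n (1ℚ - r) (λ G → sign G * transform n (- r) g G) E ≡ transform n 1ℚ (λ K → sign K * g K) E
transform-sign-conjugate n r g E =
  trans (sumℚ-cong (allSubsets n) (λ G → cong (weight (1ℚ - r) E G *_) (sign-transform n r g G)))
        (trans (transform-∘ n (1ℚ - r) r _ E)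
               (cong (λ a → transform n a _ E) (solve 1 (λ r → (con 1ℚ :- r) :+ r := con 1ℚ) refl r)))

_⊆ᵛ_ : ∀ {n} → Vec Bool n → Vec Bool n → Bool
H ⊆ᵛ E = Vec.foldr _ _∧_ true (Vec.zipWith (λ h e → not h ∨ e) H E)

disjoint : ∀ {n} → Vec Bool n → Vec Bool n → Bool
disjoint []       []       = true
disjoint (e ∷ E) (m ∷ M) = (not e ∨ not m) ∧ disjoint E M

card : ∀ {n} → Vec Bool n → ℕ
card = Vec.count (_≟ true)
  where open import Data.Bool using (_≟_)

indicator : Bool → ℚ
indicator b = if b then 1ℚ else 0ℚ

⊆ᵛ-lookup : ∀ {n} (H E : Vec Bool n) → H ⊆ᵛ E ≡ all (λ s → not (Vec.lookup H s) ∨ Vec.lookup E s) (allFin n)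
⊆ᵛ-lookup []      []      = refl
⊆ᵛ-lookup {suc n} (h ∷ H) (e ∷ E) = cong ((not h ∨ e) ∧_) (trans (⊆ᵛ-lookup H E)
  (sym (trans (cong (all (λ s → not (Vec.lookup (h ∷ H) s) ∨ Vec.lookup (e ∷ E) s)) (proj₂ (ListP.∷-injective (allFin-suc n))))
              (all-map _ Fin.suc (allFin n)))))

disjoint-lookup : ∀ {n} (E M : Vec Bool n) → disjoint E M ≡ all (λ s → not (Vec.lookup E s) ∨ not (Vec.lookup M s)) (allFin n)
disjoint-lookup []      []      = refl
disjoint-lookup {suc n} (e ∷ E) (m ∷ M) = cong ((not e ∨ not m) ∧_) (trans (disjoint-lookup E M)
  (sym (trans (cong (all (λ s → not (Vec.lookup (e ∷ E) s) ∨ not (Vec.lookup (m ∷ M) s))) (proj₂ (ListP.∷-injective (allFin-suc n))))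
              (all-map _ Fin.suc (allFin n)))))

⊆ᵛ-lookup-true : ∀ {n} {H E : Vec Bool n} → H ⊆ᵛ E ≡ true → ∀ s → Vec.lookup H s ≡ true → Vec.lookup E s ≡ true
⊆ᵛ-lookup-true {n} {H} {E} H⊆E s Hs = subst (λ b → (not b ∨ Vec.lookup E s) ≡ true) Hs
  (all-elim _ (allFin n) (trans (sym (⊆ᵛ-lookup H E)) H⊆E) (∈-allFin s))

card-mono : ∀ {n} (H G : Vec Bool n) → H ⊆ᵛ G ≡ true → card H ≤ card G
card-mono []          []          _ = z≤n
card-mono (true ∷ H)  (true ∷ G)  e = s≤s (card-mono H G e)
card-mono (false ∷ H) (true ∷ G)  e = ℕP.m≤n⇒m≤1+n (card-mono H G e)
card-mono (false ∷ H) (false ∷ G) e = card-mono H G e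

weight-support : ∀ {n} a (G H : Vec Bool n) → weight a G H ≡ 0ℚ ⊎ H ⊆ᵛ G ≡ true
weight-support a []          []          = inj₂ refl
weight-support a (true ∷ G)  (true ∷ H)  = weight-support a G H
weight-support a (true ∷ G)  (false ∷ H) with weight-support a G H
... | inj₁ w≡0 = inj₁ (trans (cong (a *_) w≡0) (ℚP.*-zeroʳ a))
... | inj₂ H⊆G = inj₂ H⊆G
weight-support a (false ∷ G) (true ∷ H)  = inj₁ refl
weight-support a (false ∷ G) (false ∷ H) = weight-support a G H

weight-0-support : ∀ {n} (G H : Vec Bool n) → weight 0ℚ G H ≡ 0ℚ ⊎ G ≡ H
weight-0-support []          []          = inj₂ refl
weight-0-support (true ∷ G)  (true ∷ H)  = map₂ (cong (true ∷_)) (weight-0-support G H)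
weight-0-support (true ∷ G)  (false ∷ H) = inj₁ (ℚP.*-zeroˡ (weight 0ℚ G H))
weight-0-support (false ∷ G) (true ∷ H)  = inj₁ refl
weight-0-support (false ∷ G) (false ∷ H) = map₂ (cong (false ∷_)) (weight-0-support G H)

insert : ∀ {n} → Vec Bool n → Fin n → Vec Bool n
insert K t = Vec.updateAt K t (λ _ → true)

weight-insert : ∀ {n} a (t : Fin n) (H K : Vec Bool n) → Vec.lookup H t ≡ true → Vec.lookup K t ≡ false →
  weight a H K ≡ a * weight a H (insert K t)
weight-insert a Fin.zero     (true ∷ H)  (false ∷ K) _ _ = refl
weight-insert a (Fin.suc t) (true ∷ H)  (true ∷ K)  Ht Kt = weight-insert a t H K Ht Kt
weight-insert a (Fin.suc t) (true ∷ H)  (false ∷ K) Ht Kt = cong (a *_) (weight-insert a t H K Ht Kt)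
weight-insert a (Fin.suc t) (false ∷ H) (true ∷ K)  _ _ = sym (ℚP.*-zeroʳ a)
weight-insert a (Fin.suc t) (false ∷ H) (false ∷ K) Ht Kt = weight-insert a t H K Ht Kt

sumSubsets-cancel : ∀ n (t : Fin n) (h : Vec Bool n → ℚ) →
  (∀ K → Vec.lookup K t ≡ false → h (insert K t) + h K ≡ 0ℚ) → sumSubsets n h ≡ 0ℚ
sumSubsets-cancel (suc n) Fin.zero h cancels =
  trans (sumSubsets-suc n h)
    (trans (sym (sumℚ-+ (allSubsets n) (h ∘ (true ∷_)) (h ∘ (false ∷_))))
           (sumℚ-0 (allSubsets n) (λ K → cancels (false ∷ K) refl)))
sumSubsets-cancel (suc n) (Fin.suc t) h cancels =
  trans (sumSubsets-suc n h)
    (cong₂ _+_ (sumSubsets-cancel n t (h ∘ (true ∷_)) (λ K → cancels (true ∷ K)))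
               (sumSubsets-cancel n t (h ∘ (false ∷_)) (λ K → cancels (false ∷ K))))

inclusion-exclusion : ∀ n (E M : Vec Bool n) →
  transform n 1ℚ (λ K → sign K * indicator (K ⊆ᵛ M)) E ≡ indicator (disjoint E M)
inclusion-exclusion zero [] [] = refl
inclusion-exclusion (suc n) (true ∷ E) (true ∷ M) =
  trans (sumSubsets-suc n (λ K → weight 1ℚ (true ∷ E) K * (sign K * indicator (K ⊆ᵛ (true ∷ M)))))
    (trans (sym (sumℚ-+ (allSubsets n) (λ K → weight 1ℚ E K * (- sign K * indicator (K ⊆ᵛ M)))
                                        (λ K → (1ℚ * weight 1ℚ E K) * (sign K * indicator (K ⊆ᵛ M)))))
      (sumℚ-0 (allSubsets n) (λ K → solve 3 (λ p s i → p :* ((:- s) :* i) :+ (con 1ℚ :* p) :* (s :* i) := con 0ℚ) refl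
         (weight 1ℚ E K) (sign K) (indicator (K ⊆ᵛ M)))))
inclusion-exclusion (suc n) (true ∷ E) (false ∷ M) =
  trans (sumSubsets-suc n (λ K → weight 1ℚ (true ∷ E) K * (sign K * indicator (K ⊆ᵛ (false ∷ M)))))
    (trans (cong₂ _+_ (sumℚ-0 (allSubsets n) (λ K → trans (cong (weight 1ℚ E K *_) (ℚP.*-zeroʳ (- sign K))) (ℚP.*-zeroʳ (weight 1ℚ E K))))
                      (trans (sumℚ-cong (allSubsets n) (λ K → cong (_* (sign K * indicator (K ⊆ᵛ M))) (ℚP.*-identityˡ (weight 1ℚ E K))))
                             (inclusion-exclusion n E M)))
           (ℚP.+-identityˡ _))
inclusion-exclusion (suc n) (false ∷ E) (m ∷ M) =
  trans (sumSubsets-suc n (λ K → weight 1ℚ (false ∷ E) K * (sign K * indicator (K ⊆ᵛ (m ∷ M)))))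
    (trans (cong₂ _+_ (sumℚ-0 (allSubsets n) (λ K → ℚP.*-zeroˡ (- sign K * indicator ((true ∷ K) ⊆ᵛ (m ∷ M))))) (inclusion-exclusion n E M))
           (ℚP.+-identityˡ _))

weight-closed-form : ∀ {n} s (G H : Vec Bool n) → (if H ⊆ᵛ G then s ^ℚ (card G ∸ card H) else 0ℚ) ≡ weight s G H
weight-closed-form s []          []          = refl
weight-closed-form s (true ∷ G)  (true ∷ H)  = weight-closed-form s G H
weight-closed-form s (true ∷ G)  (false ∷ H) with H ⊆ᵛ G in H⊆G | weight-closed-form s G H
... | true  | ih = trans (cong (s ^ℚ_) (ℕP.+-∸-assoc 1 (card-mono H G H⊆G))) (cong (s *_) ih)
... | false | ih = trans (sym (ℚP.*-zeroʳ s)) (cong (s *_) ih)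
weight-closed-form s (false ∷ G) (true ∷ H)  = refl
weight-closed-form s (false ∷ G) (false ∷ H) = weight-closed-form s G H

if-equal≡weight-0 : ∀ {n} (K G : Vec Bool n) x → (if (K ⊆ᵛ G) ∧ (G ⊆ᵛ K) then x else 0ℚ) ≡ weight 0ℚ G K * x
if-equal≡weight-0 []          []          x = sym (ℚP.*-identityˡ x)
if-equal≡weight-0 (true ∷ K)  (true ∷ G)  x = if-equal≡weight-0 K G x
if-equal≡weight-0 (true ∷ K)  (false ∷ G) x = sym (ℚP.*-zeroˡ x)
if-equal≡weight-0 (false ∷ K) (true ∷ G)  x rewrite 𝔹.∧-zeroʳ (K ⊆ᵛ G) =
  sym (trans (cong (_* x) (ℚP.*-zeroˡ (weight 0ℚ G K))) (ℚP.*-zeroˡ x))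
if-equal≡weight-0 (false ∷ K) (false ∷ G) x = if-equal≡weight-0 K G x

-1^card≡sign : ∀ {n} (G : Vec Bool n) → (- 1ℚ) ^ℚ card G ≡ sign G
-1^card≡sign []          = refl
-1^card≡sign (true ∷ G)  = trans (cong ((- 1ℚ) *_) (-1^card≡sign G))
  (trans (sym (ℚP.neg-distribˡ-* 1ℚ (sign G))) (cong -_ (ℚP.*-identityˡ (sign G))))
-1^card≡sign (false ∷ G) = -1^card≡sign G

fromℕ≡mkℚ : ∀ n → fromℕ n ≡ ℚ.mkℚ (ℤ.+ n) 0 (ℕC.sym (ℕC.1-coprimeTo n))
fromℕ≡mkℚ n = ℚP.normalize-coprime (ℕC.sym (ℕC.1-coprimeTo n))

fromℕ-suc : ∀ n → fromℕ (suc n) ≡ 1ℚ + fromℕ n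
fromℕ-suc n = ℚP.toℚᵘ-injective (begin
  ℚ.toℚᵘ (fromℕ (suc n))                          ≈⟨ ℚᵘP.≃-reflexive (cong ℚ.toℚᵘ (fromℕ≡mkℚ (suc n))) ⟩
  ℚᵘ.mkℚᵘ (ℤ.+ suc n) 0                           ≈⟨ ℚᵘ.*≡* numerators ⟩
  ℚ.toℚᵘ 1ℚ ℚᵘ.+ ℚᵘ.mkℚᵘ (ℤ.+ n) 0                ≈⟨ ℚᵘP.+-congʳ (ℚ.toℚᵘ 1ℚ) (ℚᵘP.≃-reflexive (cong ℚ.toℚᵘ (sym (fromℕ≡mkℚ n)))) ⟩
  ℚ.toℚᵘ 1ℚ ℚᵘ.+ ℚ.toℚᵘ (fromℕ n)                 ≈⟨ ℚᵘP.≃-sym (ℚP.toℚᵘ-homo-+ 1ℚ (fromℕ n)) ⟩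
  ℚ.toℚᵘ (1ℚ + fromℕ n)                           ∎)
  where
  open ℚᵘP.≃-Reasoning
  numerators : ℤ.+ suc n ℤ.* ℤ.+ 1 ≡ (ℤ.+ 1 ℤ.* ℤ.+ 1 ℤ.+ ℤ.+ n ℤ.* ℤ.+ 1) ℤ.* ℤ.+ 1
  numerators = trans (ℤP.*-identityʳ _)
    (sym (trans (ℤP.*-identityʳ _) (cong (λ i → ℤ.+ 1 ℤ.+ i) (ℤP.*-identityʳ (ℤ.+ n)))))

fromℕ-+ : ∀ m n → fromℕ (m ℕ.+ n) ≡ fromℕ m + fromℕ n
fromℕ-+ zero    n = sym (ℚP.+-identityˡ (fromℕ n))
fromℕ-+ (suc m) n = begin
  fromℕ (suc (m ℕ.+ n))         ≡⟨ fromℕ-suc (m ℕ.+ n) ⟩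
  1ℚ + fromℕ (m ℕ.+ n)          ≡⟨ cong (1ℚ +_) (fromℕ-+ m n) ⟩
  1ℚ + (fromℕ m + fromℕ n)      ≡⟨ ℚP.+-assoc 1ℚ (fromℕ m) (fromℕ n) ⟨
  (1ℚ + fromℕ m) + fromℕ n      ≡⟨ cong (_+ fromℕ n) (fromℕ-suc m) ⟨
  fromℕ (suc m) + fromℕ n       ∎
  where open ≡-Reasoning

fromℕ-* : ∀ m n → fromℕ (m ℕ.* n) ≡ fromℕ m * fromℕ n
fromℕ-* zero    n = sym (ℚP.*-zeroˡ (fromℕ n))
fromℕ-* (suc m) n = begin
  fromℕ (n ℕ.+ m ℕ.* n)          ≡⟨ fromℕ-+ n (m ℕ.* n) ⟩
  fromℕ n + fromℕ (m ℕ.* n)      ≡⟨ cong (fromℕ n +_) (fromℕ-* m n) ⟩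
  fromℕ n + fromℕ m * fromℕ n    ≡⟨ solve 2 (λ x y → x :+ y :* x := (con 1ℚ :+ y) :* x) refl (fromℕ n) (fromℕ m) ⟩
  (1ℚ + fromℕ m) * fromℕ n       ≡⟨ cong (_* fromℕ n) (fromℕ-suc m) ⟨
  fromℕ (suc m) * fromℕ n        ∎
  where open ≡-Reasoning

fromℕ-countᵇ : ∀ (p : A → Bool) xs → fromℕ (countᵇ p xs) ≡ sumℚ xs (indicator ∘ p)
fromℕ-countᵇ p []       = refl
fromℕ-countᵇ p (x ∷ xs) with p x
... | true  = trans (fromℕ-suc (countᵇ p xs)) (cong (1ℚ +_) (fromℕ-countᵇ p xs))
... | false = trans (fromℕ-countᵇ p xs) (sym (ℚP.+-identityˡ _))

1/n*n≡1 : ∀ n .{{_ : NonZero n}} → (ℤ.+ 1 / n) * fromℕ n ≡ 1ℚ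
1/n*n≡1 (suc k) = trans (cong₂ _*_ (ℚP.normalize-coprime (ℕC.1-coprimeTo (suc k))) (fromℕ≡mkℚ (suc k)))
                        (ℚP.*-inverseˡ (ℚ.mkℚ (ℤ.+ suc k) 0 (ℕC.sym (ℕC.1-coprimeTo (suc k)))))

-- Counting maps that follow a forest of pointers

-- A vertex points either to a vertex, whose colour it must copy, or directly to a colour.
Pointers : ℕ → ℕ → Set
Pointers n f = Fin n → Fin n ⊎ Fin f

target : ∀ {n f} → Fin n ⊎ Fin f → Vec (Fin f) n → Fin f
target (inj₁ w) X = Vec.lookup X w
target (inj₂ c) X = c

follows : ∀ {n f} → Pointers n f → Vec (Fin f) n → Bool
follows {n} s X = all (λ u → Vec.lookup X u == target (s u) X) (allFin n)

isRoot : ∀ {n f} → Pointers n f → Fin n → Bool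
isRoot s u = [ _== u , (λ _ → false) ]′ (s u)

Rooted : ∀ {n f} → Pointers n f → Set
Rooted s = ∀ u w → s u ≡ inj₁ w → toℕ w ≤ toℕ u × s w ≡ inj₁ w

-- The pointers of vertices 1 … n once vertex 0 has been coloured x.
pin : ∀ {n f} → Fin f → Pointers (suc n) f → Pointers n f
pin x s u with s (Fin.suc u)
... | inj₁ Fin.zero    = inj₂ x
... | inj₁ (Fin.suc w) = inj₁ w
... | inj₂ c           = inj₂ c

follows-∷ : ∀ {n f} (s : Pointers (suc n) f) x X →
  follows s (x ∷ X) ≡ (x == target (s Fin.zero) (x ∷ X)) ∧ follows (pin x s) X
follows-∷ {n} s x X = cong ((x == target (s Fin.zero) (x ∷ X)) ∧_) (begin
  all (λ u → Vec.lookup (x ∷ X) u == target (s u) (x ∷ X)) (List.tabulate Fin.suc)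
    ≡⟨ cong (all (λ u → Vec.lookup (x ∷ X) u == target (s u) (x ∷ X))) (proj₂ (ListP.∷-injective (allFin-suc n))) ⟩
  all (λ u → Vec.lookup (x ∷ X) u == target (s u) (x ∷ X)) (map Fin.suc (allFin n))
    ≡⟨ all-map _ Fin.suc (allFin n) ⟩
  all (λ u → Vec.lookup X u == target (s (Fin.suc u)) (x ∷ X)) (allFin n)
    ≡⟨ all-cong (allFin n) (λ u → cong (Vec.lookup X u ==_) (target-pin u)) ⟩
  follows (pin x s) X ∎)
  where
  open ≡-Reasoning
  target-pin : ∀ u → target (s (Fin.suc u)) (x ∷ X) ≡ target (pin x s u) X
  target-pin u with s (Fin.suc u)
  ... | inj₁ Fin.zero    = refl
  ... | inj₁ (Fin.suc w) = refl
  ... | inj₂ c           = refl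

isRoot-pin : ∀ {n f} (s : Pointers (suc n) f) x u → isRoot (pin x s) u ≡ isRoot s (Fin.suc u)
isRoot-pin s x u with s (Fin.suc u)
... | inj₁ Fin.zero    = refl
... | inj₁ (Fin.suc w) = sym (==-suc w u)
... | inj₂ c           = refl

Rooted-pin : ∀ {n f} (s : Pointers (suc n) f) x → Rooted s → Rooted (pin x s)
Rooted-pin s x rooted u w e with s (Fin.suc u) in su
Rooted-pin s x rooted u w () | inj₁ Fin.zero
Rooted-pin s x rooted u w refl | inj₁ (Fin.suc w) with rooted (Fin.suc u) (Fin.suc w) su
... | s≤s w≤u , sw rewrite sw = w≤u , refl
Rooted-pin s x rooted u w () | inj₂ c

countᵇ-∧-const : ∀ b (q : A → Bool) xs → countᵇ (λ x → b ∧ q x) xs ≡ (if b then countᵇ q xs else 0)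
countᵇ-∧-const true  q xs = refl
countᵇ-∧-const false q xs = countᵇ-false xs

sumℕ-== : ∀ {f} (c : Fin f) (g : Fin f → ℕ) → sumℕ (allFin f) (λ x → if x == c then g x else 0) ≡ g c
sumℕ-== {suc f} Fin.zero g = begin
  g Fin.zero ℕ.+ sumℕ (List.tabulate Fin.suc) (λ x → if x == Fin.zero then g x else 0)
    ≡⟨ cong (λ xs → g Fin.zero ℕ.+ sumℕ xs (λ x → if x == Fin.zero then g x else 0)) (proj₂ (ListP.∷-injective (allFin-suc f))) ⟩
  g Fin.zero ℕ.+ sumℕ (map Fin.suc (allFin f)) (λ x → if x == Fin.zero then g x else 0)
    ≡⟨ cong (g Fin.zero ℕ.+_) (trans (sumℕ-map Fin.suc (allFin f) _) (sumℕ-const (allFin f) 0)) ⟩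
  g Fin.zero ℕ.+ length (allFin f) ℕ.* 0
    ≡⟨ trans (cong (g Fin.zero ℕ.+_) (ℕP.*-zeroʳ (length (allFin f)))) (ℕP.+-identityʳ _) ⟩
  g Fin.zero ∎
  where open ≡-Reasoning
sumℕ-== {suc f} (Fin.suc c) g = begin
  sumℕ (allFin (suc f)) (λ x → if x == Fin.suc c then g x else 0)
    ≡⟨ cong (λ xs → sumℕ xs (λ x → if x == Fin.suc c then g x else 0)) (allFin-suc f) ⟩
  sumℕ (map Fin.suc (allFin f)) (λ x → if x == Fin.suc c then g x else 0)
    ≡⟨ sumℕ-map Fin.suc (allFin f) _ ⟩
  sumℕ (allFin f) (λ x → if Fin.suc x == Fin.suc c then g (Fin.suc x) else 0)
    ≡⟨ sumℕ-cong (allFin f) (λ x → cong (λ b → if b then g (Fin.suc x) else 0) (==-suc x c)) ⟩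
  sumℕ (allFin f) (λ x → if x == c then g (Fin.suc x) else 0)
    ≡⟨ sumℕ-== c (g ∘ Fin.suc) ⟩
  g (Fin.suc c) ∎
  where open ≡-Reasoning

countᵇ-allFin-suc : ∀ {n} (p : Fin (suc n) → Bool) →
  countᵇ p (allFin (suc n)) ≡ (if p Fin.zero then suc else (λ k → k)) (countᵇ (p ∘ Fin.suc) (allFin n))
countᵇ-allFin-suc {n} p with p Fin.zero
... | true  = cong suc (trans (cong (countᵇ p) (proj₂ (ListP.∷-injective (allFin-suc n)))) (countᵇ-map p Fin.suc (allFin n)))
... | false = trans (cong (countᵇ p) (proj₂ (ListP.∷-injective (allFin-suc n)))) (countᵇ-map p Fin.suc (allFin n))

countᵇ-follows : ∀ n f (s : Pointers n f) → Rooted s →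
  countᵇ (follows s) (allMaps n f) ≡ f ^ countᵇ (isRoot s) (allFin n)
countᵇ-follows zero    f s _      = refl
countᵇ-follows (suc n) f s rooted = begin
  countᵇ (follows s) (allMaps (suc n) f)
    ≡⟨ countᵇ-concatMap (follows s) (λ x → map (x ∷_) (allMaps n f)) (allFin f) ⟩
  sumℕ (allFin f) (λ x → countᵇ (follows s) (map (x ∷_) (allMaps n f)))
    ≡⟨ sumℕ-cong (allFin f) (λ x → trans (countᵇ-map (follows s) (x ∷_) (allMaps n f))
                                         (countᵇ-cong (allMaps n f) (follows-∷ s x))) ⟩
  sumℕ (allFin f) (λ x → countᵇ (λ X → (x == target (s Fin.zero) (x ∷ X)) ∧ follows (pin x s) X) (allMaps n f))
    ≡⟨ split-on-vertex-0 ⟩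
  f ^ (if isRoot s Fin.zero then suc else (λ k → k)) k
    ≡⟨ cong (f ^_) (countᵇ-allFin-suc (isRoot s)) ⟨
  f ^ countᵇ (isRoot s) (allFin (suc n)) ∎
  where
  open ≡-Reasoning
  k : ℕ
  k = countᵇ (isRoot s ∘ Fin.suc) (allFin n)

  pinned : ∀ x → countᵇ (follows (pin x s)) (allMaps n f) ≡ f ^ k
  pinned x = trans (countᵇ-follows n f (pin x s) (Rooted-pin s x rooted))
                   (cong (f ^_) (countᵇ-cong (allFin n) (isRoot-pin s x)))

  split-on-vertex-0 :
    sumℕ (allFin f) (λ x → countᵇ (λ X → (x == target (s Fin.zero) (x ∷ X)) ∧ follows (pin x s) X) (allMaps n f))
    ≡ f ^ (if isRoot s Fin.zero then suc else (λ k → k)) k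
  split-on-vertex-0 with s Fin.zero in s0
  ... | inj₁ Fin.zero = begin
    sumℕ (allFin f) (λ x → countᵇ (λ X → (x == x) ∧ follows (pin x s) X) (allMaps n f))
      ≡⟨ sumℕ-cong (allFin f) (λ x → trans (countᵇ-cong (allMaps n f) (λ X → cong (_∧ follows (pin x s) X) (==-refl x)))
                                           (pinned x)) ⟩
    sumℕ (allFin f) (λ _ → f ^ k)
      ≡⟨ trans (sumℕ-const (allFin f) (f ^ k)) (cong (ℕ._* (f ^ k)) (length-allFin f)) ⟩
    f ℕ.* f ^ k ∎
  ... | inj₁ (Fin.suc w) with () ← proj₁ (rooted Fin.zero (Fin.suc w) s0)
  ... | inj₂ c = begin
    sumℕ (allFin f) (λ x → countᵇ (λ X → (x == c) ∧ follows (pin x s) X) (allMaps n f))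
      ≡⟨ sumℕ-cong (allFin f) (λ x → countᵇ-∧-const (x == c) (follows (pin x s)) (allMaps n f)) ⟩
    sumℕ (allFin f) (λ x → if x == c then countᵇ (follows (pin x s)) (allMaps n f) else 0)
      ≡⟨ sumℕ-== c (λ x → countᵇ (follows (pin x s)) (allMaps n f)) ⟩
    countᵇ (follows (pin c s)) (allMaps n f)
      ≡⟨ pinned c ⟩
    f ^ k ∎

-- Connectivity

module Connectivity (v : ℕ) where

  end₁ end₂ : Fin (NE v) → Fin v
  end₁ t = proj₁ (endpoints t)
  end₂ t = proj₂ (endpoints t)

  joins : Fin (NE v) → Fin v → Fin v → Bool
  joins t x w = ((end₁ t == x) ∧ (end₂ t == w)) ∨ ((end₁ t == w) ∧ (end₂ t == x))

  joins⇒ : ∀ t x w → joins t x w ≡ true → (end₁ t ≡ x × end₂ t ≡ w) ⊎ (end₁ t ≡ w × end₂ t ≡ x)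
  joins⇒ t x w e with ∨-true {(end₁ t == x) ∧ (end₂ t == w)} e
  ... | inj₁ e′ = let p , q = ∧-true e′ in inj₁ (==⇒≡ p , ==⇒≡ q)
  ... | inj₂ e′ = let p , q = ∧-true e′ in inj₂ (==⇒≡ p , ==⇒≡ q)

  joins-ends : ∀ t → joins t (end₁ t) (end₂ t) ≡ true
  joins-ends t rewrite ==-refl (end₁ t) | ==-refl (end₂ t) = refl

  adj-sym : ∀ (K : EdgeSet v) x w → adj K x w ≡ adj K w x
  adj-sym K x w = any-cong (allFin (NE v)) (λ t → cong ((K ∋ t) ∧_) (𝔹.∨-comm ((end₁ t == x) ∧ (end₂ t == w)) _))

  adj⇒edge : ∀ (K : EdgeSet v) x w → adj K x w ≡ true → Σ (Fin (NE v)) λ t → (K ∋ t) ≡ true × joins t x w ≡ true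
  adj⇒edge K x w e = let t , _ , h = any-elim _ (allFin (NE v)) e in t , ∧-true {K ∋ t} h

  edge⇒adj : ∀ (K : EdgeSet v) x w t → (K ∋ t) ≡ true → joins t x w ≡ true → adj K x w ≡ true
  edge⇒adj K x w t Kt j = any-intro (λ s → (K ∋ s) ∧ joins s x w) (allFin (NE v)) (∈-allFin t) (cong₂ _∧_ Kt j)

  _⊆ₑ_ : EdgeSet v → EdgeSet v → Set
  K ⊆ₑ K′ = ∀ t → (K ∋ t) ≡ true → (K′ ∋ t) ≡ true

  adj-mono : ∀ {K K′} → K ⊆ₑ K′ → ∀ x w → adj K x w ≡ true → adj K′ x w ≡ true
  adj-mono {K} {K′} K⊆K′ x w e = let t , Kt , j = adj⇒edge K x w e in edge⇒adj K′ x w t (K⊆K′ t Kt) j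

  -- Walks with at most k edges.
  data Walk (K : EdgeSet v) : ℕ → Fin v → Fin v → Set where
    []  : ∀ {k u} → Walk K k u u
    _▸_ : ∀ {k u x w} → Walk K k u x → adj K x w ≡ true → Walk K (suc k) u w

  module _ {K : EdgeSet v} where

    weaken : ∀ {k u w} → Walk K k u w → Walk K (suc k) u w
    weaken []      = []
    weaken (p ▸ a) = weaken p ▸ a

    weaken-≤ : ∀ {k m u w} → k ≤ m → Walk K k u w → Walk K m u w
    weaken-≤ _         []      = []
    weaken-≤ (s≤s k≤m) (p ▸ a) = weaken-≤ k≤m p ▸ a

    _◂_ : ∀ {k x u w} → adj K x u ≡ true → Walk K k u w → Walk K (suc k) x w
    a ◂ []      = [] ▸ a
    a ◂ (p ▸ b) = (a ◂ p) ▸ b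

    reverse : ∀ {k u w} → Walk K k u w → Walk K k w u
    reverse []                  = []
    reverse (_▸_ {x = x} p a) = (trans (adj-sym K _ x) a ◂ reverse p)

    _++ʷ_ : ∀ {k m u x w} → Walk K k u x → Walk K m x w → Walk K (m ℕ.+ k) u w
    _++ʷ_ {k} {m} p [] = weaken-≤ (ℕP.m≤n+m k m) p
    p ++ʷ (q ▸ a) = (p ++ʷ q) ▸ a

    reachN⇒walk : ∀ k {u w} → reachN k K u w ≡ true → Walk K k u w
    reachN⇒walk zero e with ==⇒≡ e
    ... | refl = []
    reachN⇒walk (suc k) {u} {w} e with ∨-true {reachN k K u w} e
    ... | inj₁ r = weaken (reachN⇒walk k r)
    ... | inj₂ h = let x , _ , h′ = any-elim _ (allFin v) h
                       r , a = ∧-true {reachN k K u x} h′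
                   in reachN⇒walk k r ▸ a

    reachN-refl : ∀ k u → reachN k K u u ≡ true
    reachN-refl zero    u = ==-refl u
    reachN-refl (suc k) u = cong (_∨ any (λ x → reachN k K u x ∧ adj K x u) (allFin v)) (reachN-refl k u)

    walk⇒reachN : ∀ {k u w} → Walk K k u w → reachN k K u w ≡ true
    walk⇒reachN {k} {u} [] = reachN-refl k u
    walk⇒reachN {suc k} {u} {w} (_▸_ {x = x} p a) =
      trans (cong (reachN k K u w ∨_)
                  (any-intro (λ y → reachN k K u y ∧ adj K y w) (allFin v) (∈-allFin x) (cong₂ _∧_ (walk⇒reachN p) a)))
            (𝔹.∨-zeroʳ _)

  walk-mono : ∀ {K K′ k u w} → K ⊆ₑ K′ → Walk K k u w → Walk K′ k u w
  walk-mono K⊆K′ []                    = []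
  walk-mono {K} {K′} K⊆K′ (_▸_ {x = x} {w} p a) = walk-mono K⊆K′ p ▸ adj-mono {K} {K′} K⊆K′ x w a

  -- While the set of vertices reachable from u in k steps keeps growing, it has more than k
  -- elements; as there are only v vertices, it has stopped growing by step v.
  module Saturation (K : EdgeSet v) (u : Fin v) where

    reachable : ℕ → ℕ
    reachable k = countᵇ (reachN k K u) (allFin v)

    Stable : ℕ → Set
    Stable k = ∀ w → reachN (suc k) K u w ≡ reachN k K u w

    stable-suc : ∀ k → Stable k → Stable (suc k)
    stable-suc k st w =
      trans (cong (reachN (suc k) K u w ∨_) (any-cong (allFin v) (λ x → cong (_∧ adj K x w) (st x))))
            (trans (𝔹.∨-assoc (reachN k K u w) _ _) (cong (reachN k K u w ∨_) (𝔹.∨-idem _)))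

    stable-+ : ∀ k → Stable k → ∀ m w → reachN (m ℕ.+ k) K u w ≡ reachN k K u w
    stable-+ k st zero    w = refl
    stable-+ k st (suc m) w = trans (stable-suc-+ m w) (stable-+ k st m w)
      where
      stable-suc-+ : ∀ m → Stable (m ℕ.+ k)
      stable-suc-+ zero    = st
      stable-suc-+ (suc m) = stable-suc (m ℕ.+ k) (stable-suc-+ m)

    grows-or-saturated : ∀ k → suc k ≤ reachable k ⊎ (∀ m {w} → Walk K m u w → Walk K k u w)
    grows-or-saturated zero = inj₁ (countᵇ-pos (reachN 0 K u) (allFin v) (∈-allFin u) (==-refl u))
    grows-or-saturated (suc k) with grows-or-saturated k
    ... | inj₂ saturated = inj₂ (λ m p → weaken (saturated m p))
    ... | inj₁ grown with any (λ w → reachN (suc k) K u w ∧ not (reachN k K u w)) (allFin v) in new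
    ... | true = let w , w∈ , hw = any-elim _ (allFin v) new
                     r₁ , r₀ = ∧-true {reachN (suc k) K u w} hw
                 in inj₁ (ℕP.<-≤-trans (s≤s grown)
                      (countᵇ-< (reachN k K u) (reachN (suc k) K u) (allFin v) (λ x → walk⇒reachN ∘ weaken ∘ reachN⇒walk k)
                                w∈ r₁ (𝔹.not-injective r₀)))
    ... | false = inj₂ (λ m {w} p → weaken (reachN⇒walk k (trans (sym (stable-+ k stable m w))
                                                             (walk⇒reachN (weaken-≤ (ℕP.m≤m+n m k) p)))))
      where
      stable : Stable k
      stable w = ≡true-ext (λ r₁ → 𝔹.¬-not (λ r₀ → true≢false (trans (sym (any-intro _ (allFin v) (∈-allFin w) (cong₂ _∧_ r₁ (cong not r₀)))) new)))
                           (walk⇒reachN ∘ weaken ∘ reachN⇒walk k)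

    saturated : ∀ m {w} → Walk K m u w → Walk K v u w
    saturated m p with grows-or-saturated v
    ... | inj₂ h = h m p
    ... | inj₁ h = ⊥-elim (ℕP.<-irrefl refl (ℕP.<-≤-trans h
                     (subst (reachable v ≤_) (length-allFin v) (countᵇ-≤-length (reachN v K u) (allFin v)))))

  Connected : EdgeSet v → Fin v → Fin v → Set
  Connected K = Walk K v

  module _ {K : EdgeSet v} where

    connect : ∀ {m u w} → Walk K m u w → Connected K u w
    connect {m} {u} = Saturation.saturated K u m

    connected⇒ : ∀ {u w} → connected K u w ≡ true → Connected K u w
    connected⇒ = reachN⇒walk v

    ⇒connected : ∀ {u w} → Connected K u w → connected K u w ≡ true
    ⇒connected = walk⇒reachN

    conn-trans : ∀ {u x w} → Connected K u x → Connected K x w → Connected K u w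
    conn-trans p q = connect (p ++ʷ q)

    conn-adj : ∀ {x w} → adj K x w ≡ true → Connected K x w
    conn-adj a = connect ([] {k = 0} ▸ a)

  connected-cong : ∀ (K K′ : EdgeSet v) → (∀ {x y} → Connected K x y → Connected K′ x y) →
    (∀ {x y} → Connected K′ x y → Connected K x y) → ∀ x y → connected K x y ≡ connected K′ x y
  connected-cong K K′ to from x y = ≡true-ext (⇒connected ∘ to ∘ connected⇒) (⇒connected ∘ from ∘ connected⇒)

  addEdge : EdgeSet v → Fin (NE v) → EdgeSet v
  addEdge K t = mkE (insert (bits K) t)

  ∋-addEdge : ∀ K t → (addEdge K t ∋ t) ≡ true
  ∋-addEdge K t = VecP.lookup∘updateAt t (bits K)

  ∋-addEdge-other : ∀ K t s → s ≢ t → (addEdge K t ∋ s) ≡ (K ∋ s)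
  ∋-addEdge-other K t s s≢t = VecP.lookup∘updateAt′ s t s≢t (bits K)

  ⊆-addEdge : ∀ K t → K ⊆ₑ addEdge K t
  ⊆-addEdge K t s Ks with s Fin.≟ t
  ... | yes refl = ∋-addEdge K t
  ... | no s≢t   = trans (∋-addEdge-other K t s s≢t) Ks

  addEdge-removeEdge : ∀ H t → (H ∋ t) ≡ true → addEdge (removeEdge H t) t ≡ H
  addEdge-removeEdge H t Ht =
    cong mkE (trans (VecP.updateAt-updateAt-local t (bits H) (sym Ht)) (VecP.updateAt-id t (bits H)))

  adj-addEdge : ∀ K t x w → adj (addEdge K t) x w ≡ true → adj K x w ≡ true ⊎ joins t x w ≡ true
  adj-addEdge K t x w a with adj⇒edge (addEdge K t) x w a
  ... | s , Ks , j with s Fin.≟ t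
  ... | yes refl = inj₂ j
  ... | no s≢t   = inj₁ (edge⇒adj K x w s (trans (sym (∋-addEdge-other K t s s≢t)) Ks) j)

  -- In K + ab, x and y are connected iff they are connected in K or via the new edge ab.
  ConnectedVia : EdgeSet v → Fin v → Fin v → Fin v → Fin v → Set
  ConnectedVia K a b x y = Connected K x y ⊎ (Connected K x a × Connected K b y) ⊎ (Connected K x b × Connected K a y)

  module _ {K : EdgeSet v} {a b : Fin v} where

    via-extend : ∀ {x z y} → ConnectedVia K a b x z → Connected K z y → ConnectedVia K a b x y
    via-extend (inj₁ p)                q = inj₁ (conn-trans p q)
    via-extend (inj₂ (inj₁ (p₁ , p₂))) q = inj₂ (inj₁ (p₁ , conn-trans p₂ q))
    via-extend (inj₂ (inj₂ (p₁ , p₂))) q = inj₂ (inj₂ (p₁ , conn-trans p₂ q))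

    via-cross : ∀ {x} → ConnectedVia K a b x a → ConnectedVia K a b x b
    via-cross (inj₁ p)                = inj₂ (inj₁ (p , []))
    via-cross (inj₂ (inj₁ (p₁ , _)))  = inj₂ (inj₁ (p₁ , []))
    via-cross (inj₂ (inj₂ (p₁ , _)))  = inj₁ p₁

    via-cross′ : ∀ {x} → ConnectedVia K a b x b → ConnectedVia K a b x a
    via-cross′ (inj₁ p)                = inj₂ (inj₂ (p , []))
    via-cross′ (inj₂ (inj₁ (p₁ , _)))  = inj₁ p₁
    via-cross′ (inj₂ (inj₂ (p₁ , _)))  = inj₂ (inj₂ (p₁ , []))

  walk-addEdge : ∀ K t {k x y} → Walk (addEdge K t) k x y → ConnectedVia K (end₁ t) (end₂ t) x y
  walk-addEdge K t []                  = inj₁ []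
  walk-addEdge K t (_▸_ {x = z} {w} p a) with adj-addEdge K t z w a
  ... | inj₁ a′ = via-extend (walk-addEdge K t p) (conn-adj a′)
  ... | inj₂ j with joins⇒ t z w j
  ...   | inj₁ (refl , refl) = via-cross (walk-addEdge K t p)
  ...   | inj₂ (refl , refl) = via-cross′ (walk-addEdge K t p)

  connected-addEdge : ∀ K t → Connected (addEdge K t) (end₁ t) (end₂ t)
  connected-addEdge K t = conn-adj (edge⇒adj (addEdge K t) _ _ t (∋-addEdge K t) (joins-ends t))

  isLeader : EdgeSet v → Fin v → Bool
  isLeader K u = not (any (λ w → (toℕ w ℕ.<ᵇ toℕ u) ∧ connected K w u) (allFin v))

  module _ {K : EdgeSet v} where

    isLeader⇒ : ∀ {u} → isLeader K u ≡ true → ∀ w → toℕ w < toℕ u → ¬ Connected K w u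
    isLeader⇒ {u} e w w<u p = true≢false (trans (sym e) (cong not
      (any-intro (λ w → (toℕ w ℕ.<ᵇ toℕ u) ∧ connected K w u) (allFin v) (∈-allFin w)
                 (cong₂ _∧_ (Equivalence.to 𝔹.T-≡ (ℕP.<⇒<ᵇ w<u)) (⇒connected p)))))

    smaller-connected : ∀ {u} → any (λ w → (toℕ w ℕ.<ᵇ toℕ u) ∧ connected K w u) (allFin v) ≡ true →
      Σ (Fin v) λ w → toℕ w < toℕ u × Connected K w u
    smaller-connected {u} e =
      let w , _ , h = any-elim _ (allFin v) e
          w<ᵇu , c = ∧-true {toℕ w ℕ.<ᵇ toℕ u} h
      in w , ℕP.<ᵇ⇒< (toℕ w) (toℕ u) (Equivalence.from 𝔹.T-≡ w<ᵇu) , connected⇒ c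

    isLeader-intro : ∀ {u} → (∀ w → toℕ w < toℕ u → ¬ Connected K w u) → isLeader K u ≡ true
    isLeader-intro {u} h with any (λ w → (toℕ w ℕ.<ᵇ toℕ u) ∧ connected K w u) (allFin v) in e
    ... | false = refl
    ... | true  = let w , w<u , p = smaller-connected e in ⊥-elim (h w w<u p)

    find-leader : ∀ fuel u → toℕ u < fuel → Σ (Fin v) λ l → Connected K l u × isLeader K l ≡ true
    find-leader (suc fuel) u u<fuel with isLeader K u in e
    ... | true  = u , [] , e
    ... | false =
      let w , w<u , p = smaller-connected (𝔹.not-injective e)
          l , q , l-leads = find-leader fuel w (ℕP.<-≤-trans w<u (ℕP.≤-pred u<fuel))
      in l , conn-trans q p , l-leads

  leader : EdgeSet v → Fin v → Fin v
  leader K u = proj₁ (find-leader {K} (suc (toℕ u)) u ℕP.≤-refl)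

  module _ {K : EdgeSet v} where

    leader-connected : ∀ u → Connected K (leader K u) u
    leader-connected u = proj₁ (proj₂ (find-leader {K} (suc (toℕ u)) u ℕP.≤-refl))

    leader-isLeader : ∀ u → isLeader K (leader K u) ≡ true
    leader-isLeader u = proj₂ (proj₂ (find-leader {K} (suc (toℕ u)) u ℕP.≤-refl))

    leaders-unique : ∀ {x y} → isLeader K x ≡ true → isLeader K y ≡ true → Connected K x y → x ≡ y
    leaders-unique {x} {y} x-leads y-leads p with ℕP.<-cmp (toℕ x) (toℕ y)
    ... | tri< x<y _ _ = ⊥-elim (isLeader⇒ y-leads x x<y p)
    ... | tri≈ _ x≡y _ = FinP.toℕ-injective x≡y
    ... | tri> _ _ y<x = ⊥-elim (isLeader⇒ x-leads y y<x (reverse p))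

    leader-cong : ∀ {x y} → Connected K x y → leader K x ≡ leader K y
    leader-cong {x} {y} p = leaders-unique (leader-isLeader x) (leader-isLeader y)
      (conn-trans (leader-connected x) (conn-trans p (reverse (leader-connected y))))

    leader-minimal : ∀ {w u} → Connected K w u → toℕ (leader K u) ≤ toℕ w
    leader-minimal {w} {u} p = ℕP.≮⇒≥ (λ w<l → isLeader⇒ (leader-isLeader u) w w<l
      (conn-trans p (reverse (leader-connected u))))

    leader-of-leader : ∀ {u} → isLeader K u ≡ true → leader K u ≡ u
    leader-of-leader {u} u-leads = leaders-unique (leader-isLeader u) u-leads (leader-connected u)

    isLeader≡leader== : ∀ u → isLeader K u ≡ (leader K u == u)
    isLeader≡leader== u = ≡true-ext (λ e → trans (cong (_== u) (leader-of-leader e)) (==-refl u))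
                                    (λ e → subst (λ z → isLeader K z ≡ true) (==⇒≡ e) (leader-isLeader u))

  c-cong : ∀ K K′ → (∀ x y → connected K x y ≡ connected K′ x y) → c K ≡ c K′
  c-cong K K′ h = countᵇ-cong (allFin v) (λ u → cong not (any-cong (allFin v) (λ w → cong ((toℕ w ℕ.<ᵇ toℕ u) ∧_) (h w u))))

  via-swap : ∀ {K a b x y} → ConnectedVia K a b x y → ConnectedVia K b a x y
  via-swap (inj₁ p)        = inj₁ p
  via-swap (inj₂ (inj₁ p)) = inj₂ (inj₂ p)
  via-swap (inj₂ (inj₂ p)) = inj₂ (inj₁ p)

  -- Joining p and q merges two components: the leader of q's component stops being a leader.
  c-merge : ∀ K K′ p q → (∀ {x y} → Connected K′ x y → ConnectedVia K p q x y) →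
    (∀ {x y} → Connected K x y → Connected K′ x y) → Connected K′ p q →
    toℕ (leader K p) < toℕ (leader K q) → suc (c K′) ≡ c K
  c-merge K K′ p q via lift pq lp<lq =
    sym (trans (countᵇ-remove (isLeader K) (leader K q) (leader-isLeader q))
               (cong suc (countᵇ-cong (allFin v) (λ u → sym (leaders-of-K′ u)))))
    where
    leaders-of-K′ : ∀ u → isLeader K′ u ≡ (isLeader K u ∧ not (u == leader K q))
    leaders-of-K′ u = ≡true-ext to from
      where
      to : isLeader K′ u ≡ true → (isLeader K u ∧ not (u == leader K q)) ≡ true
      to e = cong₂ _∧_ (isLeader-intro (λ w w<u p → isLeader⇒ e w w<u (lift p)))
                       (cong not (𝔹.¬-not not-lq))
        where
        not-lq : (u == leader K q) ≢ true
        not-lq u=lq with ==⇒≡ u=lq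
        ... | refl = isLeader⇒ e (leader K p) lp<lq
                       (conn-trans (lift (leader-connected p)) (conn-trans pq (lift (reverse (leader-connected q)))))
      from : (isLeader K u ∧ not (u == leader K q)) ≡ true → isLeader K′ u ≡ true
      from e with ∧-true {isLeader K u} e
      ... | u-leads , u≢lq = isLeader-intro no-smaller
        where
        u≡leader : ∀ {x} → Connected K x u → leader K x ≡ u
        u≡leader xu = trans (leader-cong xu) (leader-of-leader u-leads)
        no-smaller : ∀ w → toℕ w < toℕ u → ¬ Connected K′ w u
        no-smaller w w<u wu with via wu
        ... | inj₁ wu′ = isLeader⇒ u-leads w w<u wu′
        ... | inj₂ (inj₁ (_ , qu)) =
              true≢false (trans (sym u≢lq) (cong not (trans (cong (u ==_) (u≡leader qu)) (==-refl u))))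
        ... | inj₂ (inj₂ (wq , pu)) = ℕP.<-irrefl refl (ℕP.<-≤-trans lp<lq (ℕP.≤-trans (leader-minimal wq)
                (ℕP.<⇒≤ (subst (λ z → toℕ w < toℕ z) (sym (u≡leader pu)) w<u))))

  c-addEdge-connected : ∀ K t → Connected K (end₁ t) (end₂ t) → c (addEdge K t) ≡ c K
  c-addEdge-connected K t ab = c-cong (addEdge K t) K (connected-cong (addEdge K t) K (unvia ∘ walk-addEdge K t) (walk-mono (⊆-addEdge K t)))
    where
    unvia : ∀ {x y} → ConnectedVia K (end₁ t) (end₂ t) x y → Connected K x y
    unvia (inj₁ xy)               = xy
    unvia (inj₂ (inj₁ (xa , by))) = conn-trans xa (conn-trans ab by)
    unvia (inj₂ (inj₂ (xb , ay))) = conn-trans xb (conn-trans (reverse ab) ay)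

  c-addEdge-disconnected : ∀ K t → ¬ Connected K (end₁ t) (end₂ t) → suc (c (addEdge K t)) ≡ c K
  c-addEdge-disconnected K t ¬ab with ℕP.<-cmp (toℕ (leader K (end₁ t))) (toℕ (leader K (end₂ t)))
  ... | tri< l₁<l₂ _ _ = c-merge K (addEdge K t) (end₁ t) (end₂ t) (walk-addEdge K t) (walk-mono (⊆-addEdge K t))
                           (connected-addEdge K t) l₁<l₂
  ... | tri≈ _ l₁≡l₂ _ = ⊥-elim (¬ab (conn-trans (reverse (leader-connected (end₁ t)))
                           (subst (λ z → Connected K z (end₂ t)) (sym (FinP.toℕ-injective l₁≡l₂)) (leader-connected (end₂ t)))))
  ... | tri> _ _ l₂<l₁ = c-merge K (addEdge K t) (end₂ t) (end₁ t) (via-swap ∘ walk-addEdge K t) (walk-mono (⊆-addEdge K t))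
                           (reverse (connected-addEdge K t)) l₂<l₁

  c-addEdge-isthmus : ∀ H t → (H ∋ t) ≡ true → c H ≢ c (removeEdge H t) →
    ∀ K → (K ∋ t) ≡ false → K ⊆ₑ H → suc (c (addEdge K t)) ≡ c K
  c-addEdge-isthmus H t Ht c≢ K Kt K⊆H = c-addEdge-disconnected K t (¬ab-in-H∖t ∘ walk-mono K⊆H∖t)
    where
    K⊆H∖t : K ⊆ₑ removeEdge H t
    K⊆H∖t s Ks with s Fin.≟ t
    ... | yes refl = ⊥-elim (true≢false (trans (sym Ks) Kt))
    ... | no s≢t   = trans (VecP.lookup∘updateAt′ s t s≢t (bits H)) (K⊆H s Ks)
    ¬ab-in-H∖t : ¬ Connected (removeEdge H t) (end₁ t) (end₂ t)
    ¬ab-in-H∖t ab = c≢ (trans (cong c (sym (addEdge-removeEdge H t Ht))) (c-addEdge-connected (removeEdge H t) t ab))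

  -- Colourings constant on the components of K

  monochromatic : ∀ {f} → Vec (Fin f) v → Vec Bool (NE v)
  monochromatic X = Vec.tabulate (λ t → Vec.lookup X (end₁ t) == Vec.lookup X (end₂ t))

  ConstantOn : ∀ {f} → EdgeSet v → Vec (Fin f) v → Set
  ConstantOn K X = ∀ t → (K ∋ t) ≡ true → Vec.lookup X (end₁ t) ≡ Vec.lookup X (end₂ t)

  module _ {f} (K : EdgeSet v) (X : Vec (Fin f) v) where

    ⊆monochromatic⇒ : bits K ⊆ᵛ monochromatic X ≡ true → ConstantOn K X
    ⊆monochromatic⇒ e t Kt = ==⇒≡ (trans (sym (VecP.lookup∘tabulate _ t))
      (subst (λ b → (not b ∨ Vec.lookup (monochromatic X) t) ≡ true) Kt
             (all-elim _ (allFin (NE v)) (trans (sym (⊆ᵛ-lookup (bits K) (monochromatic X))) e) (∈-allFin t))))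

    ⇒⊆monochromatic : ConstantOn K X → bits K ⊆ᵛ monochromatic X ≡ true
    ⇒⊆monochromatic h = trans (⊆ᵛ-lookup (bits K) (monochromatic X)) (all-intro _ (allFin (NE v)) edgewise)
      where
      edgewise : ∀ t → t ∈ allFin (NE v) → (not (K ∋ t) ∨ Vec.lookup (monochromatic X) t) ≡ true
      edgewise t _ with K ∋ t in Kt
      ... | false = refl
      ... | true  = trans (VecP.lookup∘tabulate _ t) (trans (cong (_== Vec.lookup X (end₂ t)) (h t Kt)) (==-refl _))

    walk-constant : ConstantOn K X → ∀ {k u w} → Walk K k u w → Vec.lookup X u ≡ Vec.lookup X w
    walk-constant h []                  = refl
    walk-constant h (_▸_ {x = z} {w} p a) with adj⇒edge K z w a
    ... | t , Kt , j with joins⇒ t z w j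
    ...   | inj₁ (refl , refl) = trans (walk-constant h p) (h t Kt)
    ...   | inj₂ (refl , refl) = trans (walk-constant h p) (sym (h t Kt))

  leaderPointers : ∀ {f} → EdgeSet v → Pointers v f
  leaderPointers K = inj₁ ∘ leader K

  leaderPointers-rooted : ∀ {f} K → Rooted {v} {f} (leaderPointers K)
  leaderPointers-rooted K u .(leader K u) refl =
    leader-minimal [] , cong inj₁ (leader-cong (leader-connected u))

  ⊆monochromatic≡follows : ∀ {f} K (X : Vec (Fin f) v) → bits K ⊆ᵛ monochromatic X ≡ follows (leaderPointers K) X
  ⊆monochromatic≡follows K X = ≡true-ext to from
    where
    to : bits K ⊆ᵛ monochromatic X ≡ true → follows (leaderPointers K) X ≡ true
    to e = all-intro _ (allFin v) (λ u _ →
      trans (cong (Vec.lookup X u ==_) (walk-constant K X (⊆monochromatic⇒ K X e) (leader-connected u))) (==-refl _))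
    from : follows (leaderPointers K) X ≡ true → bits K ⊆ᵛ monochromatic X ≡ true
    from e = ⇒⊆monochromatic K X (λ t Kt →
      trans (at-leader (end₁ t)) (trans (cong (Vec.lookup X) (leader-cong (conn-adj (edge⇒adj K _ _ t Kt (joins-ends t)))))
                                        (sym (at-leader (end₂ t)))))
      where
      at-leader : ∀ u → Vec.lookup X u ≡ Vec.lookup X (leader K u)
      at-leader u = ==⇒≡ (all-elim _ (allFin v) e (∈-allFin u))

  countᵇ-constant-on-components : ∀ f K → countᵇ (λ X → bits K ⊆ᵛ monochromatic X) (allMaps v f) ≡ f ^ c K
  countᵇ-constant-on-components f K = begin
    countᵇ (λ X → bits K ⊆ᵛ monochromatic X) (allMaps v f)
      ≡⟨ countᵇ-cong (allMaps v f) (⊆monochromatic≡follows K) ⟩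
    countᵇ (follows (leaderPointers K)) (allMaps v f)
      ≡⟨ countᵇ-follows v f (leaderPointers K) (leaderPointers-rooted K) ⟩
    f ^ countᵇ (isRoot (leaderPointers {f} K)) (allFin v)
      ≡⟨ cong (f ^_) (countᵇ-cong (allFin v) (λ u → sym (isLeader≡leader== u))) ⟩
    f ^ c K ∎
    where open ≡-Reasoning

  -- Whitney's expansion of the chromatic polynomial

  disjoint-monochromatic≡proper : ∀ {f} (E : EdgeSet v) (X : Vec (Fin f) v) → disjoint (bits E) (monochromatic X) ≡ proper E X
  disjoint-monochromatic≡proper E X = trans (disjoint-lookup (bits E) (monochromatic X))
    (all-cong (allFin (NE v)) (λ t → cong (λ b → not (E ∋ t) ∨ not b) (VecP.lookup∘tabulate _ t)))

  whitney : ∀ f (E : EdgeSet v) →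
    transform (NE v) 1ℚ (λ K → sign K * fromℕ (f ^ c (mkE {v} K))) (bits E) ≡ fromℕ (chromatic v f E)
  whitney f E = begin
    sumSubsets n (λ K → weight 1ℚ (bits E) K * (sign K * fromℕ (f ^ c (mkE {v} K))))
      ≡⟨ sumℚ-cong (allSubsets n) (λ K → cong (λ z → weight 1ℚ (bits E) K * (sign K * z)) (colourings K)) ⟩
    sumSubsets n (λ K → weight 1ℚ (bits E) K * (sign K * sumℚ Xs (λ X → indicator (K ⊆ᵛ monochromatic X))))
      ≡⟨ sumℚ-cong (allSubsets n) (λ K → pull-in (weight 1ℚ (bits E) K) (sign K) (λ X → indicator (K ⊆ᵛ monochromatic X))) ⟩
    sumSubsets n (λ K → sumℚ Xs (λ X → weight 1ℚ (bits E) K * (sign K * indicator (K ⊆ᵛ monochromatic X))))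
      ≡⟨ sumℚ-comm (allSubsets n) Xs (λ K X → weight 1ℚ (bits E) K * (sign K * indicator (K ⊆ᵛ monochromatic X))) ⟩
    sumℚ Xs (λ X → transform n 1ℚ (λ K → sign K * indicator (K ⊆ᵛ monochromatic X)) (bits E))
      ≡⟨ sumℚ-cong Xs (λ X → trans (inclusion-exclusion n (bits E) (monochromatic X))
                                   (cong indicator (disjoint-monochromatic≡proper E X))) ⟩
    sumℚ Xs (λ X → indicator (proper E X))
      ≡⟨ fromℕ-countᵇ (proper E) Xs ⟨
    fromℕ (chromatic v f E) ∎
    where
    open ≡-Reasoning
    n : ℕ
    n = NE v
    Xs : List (Vec (Fin f) v)
    Xs = allMaps v f
    colourings : ∀ K → fromℕ (f ^ c (mkE {v} K)) ≡ sumℚ Xs (λ X → indicator (K ⊆ᵛ monochromatic X))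
    colourings K = trans (cong fromℕ (sym (countᵇ-constant-on-components f (mkE K))))
                         (fromℕ-countᵇ (λ X → K ⊆ᵛ monochromatic X) Xs)
    pull-in : ∀ a b (g : Vec (Fin f) v → ℚ) → a * (b * sumℚ Xs g) ≡ sumℚ Xs (λ X → a * (b * g X))
    pull-in a b g = sym (trans (sumℚ-*ˡ Xs a (λ X → b * g X)) (cong (a *_) (sumℚ-*ˡ Xs b g)))

-- Sums over the isthmus-free edge sets

∈P⇒isthmusFree : ∀ {v} {E : EdgeSet v} → E ∈ P v → isthmusFree E ≡ true
∈P⇒isthmusFree {v} E∈P = Equivalence.to 𝔹.T-≡ (proj₂ (∈-filter⁻ (T? ∘ isthmusFree) {xs = map mkE (allSubsets (NE v))} E∈P))

sumP≡sumSubsets : ∀ v (h : EdgeSet v → ℚ) → (∀ K → isthmusFree (mkE {v} K) ≡ false → h (mkE K) ≡ 0ℚ) →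
  sumP v h ≡ sumSubsets (NE v) (h ∘ mkE)
sumP≡sumSubsets v h vanishes = begin
  sumℚ (filterᵇ isthmusFree (map mkE (allSubsets (NE v)))) h
    ≡⟨ sumℚ-filterᵇ isthmusFree (map mkE (allSubsets (NE v))) h ⟩
  sumℚ (map mkE (allSubsets (NE v))) (λ E → if isthmusFree E then h E else 0ℚ)
    ≡⟨ sumℚ-map mkE (allSubsets (NE v)) (λ E → if isthmusFree E then h E else 0ℚ) ⟩
  sumSubsets (NE v) (λ K → if isthmusFree (mkE {v} K) then h (mkE K) else 0ℚ)
    ≡⟨ sumℚ-cong (allSubsets (NE v)) extend ⟩
  sumSubsets (NE v) (h ∘ mkE) ∎
  where
  open ≡-Reasoning
  extend : ∀ K → (if isthmusFree (mkE {v} K) then h (mkE K) else 0ℚ) ≡ h (mkE K)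
  extend K with isthmusFree (mkE {v} K) in free
  ... | true  = refl
  ... | false = sym (vanishes K free)

δ≡weight-0 : ∀ {v} (G K : Vec Bool (NE v)) → δ (mkE {v} G) (mkE K) ≡ weight 0ℚ G K
δ≡weight-0 G K = trans (cong indicator (𝔹.∧-comm (G ⊆ᵛ K) (K ⊆ᵛ G)))
                       (trans (if-equal≡weight-0 K G 1ℚ) (ℚP.*-identityʳ (weight 0ℚ G K)))

signMat≡weight-0 : ∀ {v} (K G : Vec Bool (NE v)) → signMat v (mkE K) (mkE G) ≡ weight 0ℚ G K * sign K
signMat≡weight-0 K G = trans (if-equal≡weight-0 K G ((- 1ℚ) ^ℚ card K)) (cong (weight 0ℚ G K *_) (-1^card≡sign K))

-- Imported only here, since its prefix +_ makes sections such as (x +_) ambiguous.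
open import Data.Integer using (+_)

module Corollary (v f : ℕ) .{{_ : NonZero f}} (Jinv : Mat v) (inv : IsInverse v (J v ((+ 1) / f)) Jinv) where

  open Connectivity v

  n : ℕ
  n = NE v

  r : ℚ
  r = (+ 1) / f

  fᶜ : Vec Bool n → ℚ
  fᶜ K = fromℕ (f ^ c (mkE {v} K))

  -- J_r⁻¹ f^c, computed on the whole Boolean lattice rather than on P_V.
  y : Vec Bool n → ℚ
  y = transform n (- r) fᶜ

  c-unchanged : Vec Bool n → Fin n → Bool
  c-unchanged H t = c (mkE {v} H) ℕ.≡ᵇ c (removeEdge (mkE {v} H) t)

  notIsthmus : Vec Bool n → Fin n → Bool
  notIsthmus H t = not (Vec.lookup H t) ∨ c-unchanged H t

  -- An isthmus t of H pairs each K ⊆ H ∖ t with K + t, and f^c(K) = f · f^c(K + t) makes the pair cancel.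
  y-vanishes-at-isthmus : ∀ H t → notIsthmus H t ≡ false → y H ≡ 0ℚ
  y-vanishes-at-isthmus H t t-isthmus = sumSubsets-cancel n t (λ K → weight (- r) H K * fᶜ K) cancel
    where
    Ht : Vec.lookup H t ≡ true
    Ht = 𝔹.not-injective (𝔹.∨-conicalˡ (not (Vec.lookup H t)) (c-unchanged H t) t-isthmus)
    c≢ : c (mkE {v} H) ≢ c (removeEdge (mkE {v} H) t)
    c≢ eq = true≢false (trans (sym (Equivalence.to 𝔹.T-≡ (ℕP.≡⇒≡ᵇ (c (mkE {v} H)) (c (removeEdge (mkE {v} H) t)) eq)))
                              (𝔹.∨-conicalʳ (not (Vec.lookup H t)) (c-unchanged H t) t-isthmus))
    cancel : ∀ K → Vec.lookup K t ≡ false →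
      weight (- r) H (insert K t) * fᶜ (insert K t) + weight (- r) H K * fᶜ K ≡ 0ℚ
    cancel K Kt = by-support (weight-support (- r) H (insert K t))
      where
      by-support : weight (- r) H (insert K t) ≡ 0ℚ ⊎ insert K t ⊆ᵛ H ≡ true →
        weight (- r) H (insert K t) * fᶜ (insert K t) + weight (- r) H K * fᶜ K ≡ 0ℚ
      by-support (inj₁ w≡0) =
        trans (cong₂ _+_ (cong (_* fᶜ (insert K t)) w≡0)
                         (cong (_* fᶜ K) (trans (weight-insert (- r) t H K Ht Kt)
                                                (trans (cong ((- r) *_) w≡0) (ℚP.*-zeroʳ (- r))))))
              (trans (cong₂ _+_ (ℚP.*-zeroˡ (fᶜ (insert K t))) (ℚP.*-zeroˡ (fᶜ K))) (ℚP.+-identityˡ 0ℚ))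
      by-support (inj₂ K+t⊆H) = begin
        w * F + weight (- r) H K * fᶜ K
          ≡⟨ cong₂ (λ a b → w * F + a * b) (weight-insert (- r) t H K Ht Kt) fᶜK≡f*F ⟩
        w * F + ((- r) * w) * (fromℕ f * F)
          ≡⟨ solve 4 (λ w F r φ → w :* F :+ ((:- r) :* w) :* (φ :* F) := w :* F :+ (:- (r :* φ)) :* (w :* F)) refl w F r (fromℕ f) ⟩
        w * F + (- (r * fromℕ f)) * (w * F)
          ≡⟨ cong (λ z → w * F + (- z) * (w * F)) (1/n*n≡1 f) ⟩
        w * F + (- 1ℚ) * (w * F)
          ≡⟨ solve 1 (λ x → x :+ (:- con 1ℚ) :* x := con 0ℚ) refl (w * F) ⟩
        0ℚ ∎
        where
        open ≡-Reasoning
        w F : ℚ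
        w = weight (- r) H (insert K t)
        F = fᶜ (insert K t)
        K⊆H : mkE K ⊆ₑ mkE H
        K⊆H s Ks = ⊆ᵛ-lookup-true {H = insert K t} {E = H} K+t⊆H s (⊆-addEdge (mkE K) t s Ks)
        fᶜK≡f*F : fᶜ K ≡ fromℕ f * F
        fᶜK≡f*F = trans (cong (λ k → fromℕ (f ^ k)) (sym (c-addEdge-isthmus (mkE H) t Ht c≢ (mkE K) Kt K⊆H)))
                        (fromℕ-* f (f ^ c (mkE {v} (insert K t))))

  y-vanishes : ∀ H → isthmusFree (mkE {v} H) ≡ false → y H ≡ 0ℚ
  y-vanishes H not-free =
    let t , _ , t-isthmus = all≡false⇒∃ (notIsthmus H) (allFin n) not-free in y-vanishes-at-isthmus H t t-isthmus

  vanishes-off-P : ∀ (g : Vec Bool n → ℚ) K → isthmusFree (mkE {v} K) ≡ false → g K * y K ≡ 0ℚ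
  vanishes-off-P g K not-free = trans (cong (g K *_) (y-vanishes K not-free)) (ℚP.*-zeroʳ (g K))

  fᶜ≡J·y : ∀ H → fᶜ H ≡ sumP v (λ K → J v r (mkE H) K * y (bits K))
  fᶜ≡J·y H = sym (begin
    sumP v (λ K → J v r (mkE H) K * y (bits K))
      ≡⟨ sumP≡sumSubsets v (λ K → J v r (mkE H) K * y (bits K)) (vanishes-off-P (J v r (mkE H) ∘ mkE)) ⟩
    sumSubsets n (λ K → J v r (mkE H) (mkE K) * y K)
      ≡⟨ sumℚ-cong (allSubsets n) (λ K → cong (_* y K) (weight-closed-form r H K)) ⟩
    transform n r y H
      ≡⟨ transform-inverse n r fᶜ H ⟩
    fᶜ H ∎)
    where open ≡-Reasoning

  Jinv·fᶜ≡y : ∀ G → G ∈ P v → sumP v (λ H → Jinv G H * fromℕ (f ^ c H)) ≡ y (bits G)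
  Jinv·fᶜ≡y G G∈P = begin
    sumP v (λ H → Jinv G H * fᶜ (bits H))
      ≡⟨ sumℚ-cong (P v) (λ H → trans (cong (Jinv G H *_) (fᶜ≡J·y (bits H)))
                                       (sym (sumℚ-*ˡ (P v) (Jinv G H) (λ K → J v r H K * y (bits K))))) ⟩
    sumP v (λ H → sumP v (λ K → Jinv G H * (J v r H K * y (bits K))))
      ≡⟨ sumℚ-comm (P v) (P v) (λ H K → Jinv G H * (J v r H K * y (bits K))) ⟩
    sumP v (λ K → sumP v (λ H → Jinv G H * (J v r H K * y (bits K))))
      ≡⟨ sumℚ-cong∈ (P v) (λ K K∈P → trans (sumℚ-cong (P v) (λ H → sym (ℚP.*-assoc (Jinv G H) (J v r H K) (y (bits K)))))
                                   (trans (sumℚ-*ʳ (P v) (y (bits K)) (λ H → Jinv G H * J v r H K))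
                                          (cong (_* y (bits K)) (proj₂ (inv G K G∈P K∈P))))) ⟩
    sumP v (λ K → δ G K * y (bits K))
      ≡⟨ sumP≡sumSubsets v (λ K → δ G K * y (bits K)) (vanishes-off-P (δ G ∘ mkE)) ⟩
    sumSubsets n (λ K → δ G (mkE K) * y K)
      ≡⟨ sumℚ-cong (allSubsets n) (λ K → cong (_* y K) (δ≡weight-0 {v} (bits G) K)) ⟩
    transform n 0ℚ y (bits G)
      ≡⟨ transform-0 n y (bits G) ⟩
    y (bits G) ∎
    where open ≡-Reasoning

  J·sign-entry : ∀ E G → G ∈ P v →
    (J v (1ℚ - r) · signMat v) E G ≡ weight (1ℚ - r) (bits E) (bits G) * sign (bits G)
  J·sign-entry E G G∈P = begin
    sumP v (λ K → J v (1ℚ - r) E K * signMat v K G)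
      ≡⟨ sumP≡sumSubsets v (λ K → J v (1ℚ - r) E K * signMat v K G) off-diagonal ⟩
    sumSubsets n (λ K → J v (1ℚ - r) E (mkE K) * signMat v (mkE K) G)
      ≡⟨ sumℚ-cong (allSubsets n) (λ K → trans (cong₂ _*_ (weight-closed-form (1ℚ - r) (bits E) K) (signMat≡weight-0 {v} K (bits G)))
           (solve 3 (λ a b s → a :* (b :* s) := b :* (a :* s)) refl (weight (1ℚ - r) (bits E) K) (weight 0ℚ (bits G) K) (sign K))) ⟩
    transform n 0ℚ (λ K → weight (1ℚ - r) (bits E) K * sign K) (bits G)
      ≡⟨ transform-0 n (λ K → weight (1ℚ - r) (bits E) K * sign K) (bits G) ⟩
    weight (1ℚ - r) (bits E) (bits G) * sign (bits G) ∎
    where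
    open ≡-Reasoning
    off-diagonal : ∀ K → isthmusFree (mkE {v} K) ≡ false → J v (1ℚ - r) E (mkE K) * signMat v (mkE K) G ≡ 0ℚ
    off-diagonal K not-free with weight-0-support (bits G) K
    ... | inj₁ w≡0  = trans (cong (J v (1ℚ - r) E (mkE K) *_) (trans (signMat≡weight-0 {v} K (bits G))
                                (trans (cong (_* sign K) w≡0) (ℚP.*-zeroˡ (sign K)))))
                            (ℚP.*-zeroʳ (J v (1ℚ - r) E (mkE K)))
    ... | inj₂ refl = ⊥-elim (true≢false (trans (sym (∈P⇒isthmusFree G∈P)) not-free))

  M·fᶜ≡χ : ∀ E → sumP v (λ H → M v r Jinv E H * fromℕ (f ^ c H)) ≡ fromℕ (chromatic v f E)
  M·fᶜ≡χ E = begin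
    sumP v (λ H → sumP v (λ G → Jσ E G * Jinv G H) * fᶜ (bits H))
      ≡⟨ sumℚ-cong (P v) (λ H → trans (sym (sumℚ-*ʳ (P v) (fᶜ (bits H)) (λ G → Jσ E G * Jinv G H)))
                                       (sumℚ-cong (P v) (λ G → ℚP.*-assoc (Jσ E G) (Jinv G H) (fᶜ (bits H))))) ⟩
    sumP v (λ H → sumP v (λ G → Jσ E G * (Jinv G H * fᶜ (bits H))))
      ≡⟨ sumℚ-comm (P v) (P v) (λ H G → Jσ E G * (Jinv G H * fᶜ (bits H))) ⟩
    sumP v (λ G → sumP v (λ H → Jσ E G * (Jinv G H * fᶜ (bits H))))
      ≡⟨ sumℚ-cong∈ (P v) (λ G G∈P → trans (sumℚ-*ˡ (P v) (Jσ E G) (λ H → Jinv G H * fᶜ (bits H)))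
                                            (cong₂ _*_ (J·sign-entry E G G∈P) (Jinv·fᶜ≡y G G∈P))) ⟩
    sumP v (λ G → weight (1ℚ - r) (bits E) (bits G) * sign (bits G) * y (bits G))
      ≡⟨ sumP≡sumSubsets v (λ G → weight (1ℚ - r) (bits E) (bits G) * sign (bits G) * y (bits G))
                        (vanishes-off-P (λ G → weight (1ℚ - r) (bits E) G * sign G)) ⟩
    sumSubsets n (λ G → weight (1ℚ - r) (bits E) G * sign G * y G)
      ≡⟨ sumℚ-cong (allSubsets n) (λ G → ℚP.*-assoc (weight (1ℚ - r) (bits E) G) (sign G) (y G)) ⟩
    transform n (1ℚ - r) (λ G → sign G * y G) (bits E)
      ≡⟨ transform-sign-conjugate n r fᶜ (bits E) ⟩
    transform n 1ℚ (λ K → sign K * fᶜ K) (bits E)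
      ≡⟨ whitney f E ⟩
    fromℕ (chromatic v f E) ∎
    where
    open ≡-Reasoning
    Jσ : Mat v
    Jσ = J v (1ℚ - r) · signMat v

corollary3 : (v f : ℕ) → .{{_ : NonZero f}} → (Jinv : Mat v) → IsInverse v (J v ((+ 1) / f)) Jinv →
    (E : EdgeSet v) → E ∈ P v →
    fromℕ (chromatic v f E) ≡ sumP v (λ H → M v ((+ 1) / f) Jinv E H * fromℕ (f ^ c H))
corollary3 v f Jinv inv E _ = sym (Corollary.M·fᶜ≡χ v f Jinv inv E)
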